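{- Let $n\ge1$ and $0\le k<n$. The number of recurrent configurations $c$ on the fan graph $F_n$ with $\mathrm{level}(c)=k$ equals $\sum_{r=0}^{n-k-1}\binom{n-k-1}{r}\binom{r+k}{r}$.
   Context: The fan graph $F_n$ has vertex set $\{0,\dots,n\}$, edges $\{i,i+1\}$ ($i\in[n-1]$) and $\{0,i\}$ ($i\in[n]$); $0$ is the sink. Abelian sandpile model: a configuration is $c\in\mathbb{Z}_{\ge0}^n$, stable if $c_i<\deg(i)$ for all $i\in[n]$. Toppling an unstable $i$ removes $\deg(i)$ grains from $i$ and gives one to each neighbour (grains sent to $0$ are lost); repeated toppling gives a unique stabilisation. With a distribution $\mu$ on $[n]$, all $\mu_i>0$, the Markov chain on stable configurations adds a grain at $i$ with probability $\mu_i$ and stabilises; recurrent configurations are its recurrent states. The level of $c$ is $\sum_ic_i+\deg(0)-|E(F_n)|=\sum_ic_i-n+1$. -}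

module Defs where

open import Data.Nat using (ℕ; zero; suc; _+_; _*_; _∸_; _≤_; _<_; _<ᵇ_; _≡ᵇ_)
open import Data.Nat.Combinatorics using (_C_)
open import Data.Bool using (Bool; true; false; if_then_else_; _∨_)
open import Data.Fin using (Fin; toℕ)
open import Data.Vec using (Vec; lookup; tabulate; updateAt)
import Data.Vec as Vec
open import Data.List using (List; map; upTo; length)
open import Data.Nat.ListAction using () renaming (sum to listSum)
open import Data.Product using (Σ; ∃; _×_)
open import Data.List.Relation.Unary.Unique.Propositional using (Unique)
open import Data.List.Membership.Propositional using (_∈_)
open import Function.Bundles using (_⇔_)
open import Relation.Binary.PropositionalEquality using (_≡_)
open import Relation.Binary.Construct.Closure.ReflexiveTransitive using (Star)

-- Fan graph F_n: non-sink vertex i ∈ [n] is represented by j : Fin n with toℕ j = i - 1.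
-- Path edges {i,i+1}, and every non-sink vertex is adjacent to the sink 0.

deg : {n : ℕ} → Fin n → ℕ
deg {n} i = suc ((if 0 <ᵇ toℕ i then 1 else 0) + (if suc (toℕ i) <ᵇ n then 1 else 0))

adjB : {n : ℕ} → Fin n → Fin n → Bool
adjB i j = (suc (toℕ i) ≡ᵇ toℕ j) ∨ (suc (toℕ j) ≡ᵇ toℕ i)

Config : ℕ → Set
Config n = Vec ℕ n

Stable : {n : ℕ} → Config n → Set
Stable c = ∀ i → lookup c i < deg i

-- Toppling vertex i (used only when deg i ≤ c_i, so ∸ is exact):
-- i loses deg i grains, each path neighbour gains one (the grain sent to the sink is lost).
topple : {n : ℕ} → Fin n → Config n → Config n
topple i c = tabulate λ j →
  (lookup c j ∸ (if toℕ j ≡ᵇ toℕ i then deg i else 0)) + (if adjB i j then 1 else 0)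

data _⟶*_ {n : ℕ} : Config n → Config n → Set where
  done : ∀ {c} → c ⟶* c
  step : ∀ {c d} (i : Fin n) → deg i ≤ lookup c i → topple i c ⟶* d → c ⟶* d

Stabilises : {n : ℕ} → Config n → Config n → Set
Stabilises c d = (c ⟶* d) × Stable d

addGrain : {n : ℕ} → Fin n → Config n → Config n
addGrain i c = updateAt c i suc

-- One step of the sandpile Markov chain with positive-everywhere distribution μ:
-- from stable c, add a grain at some vertex i (μ_i > 0) and stabilise.
Step : {n : ℕ} → Config n → Config n → Set
Step c d = Stable c × ∃ λ i → Stabilises (addGrain i c) d

Recurrent : {n : ℕ} → Config n → Set
Recurrent c = Stable c × (∀ d → Star Step c d → Star Step d c)

-- level(c) = Σ c_i - n + 1, stated as the equation Σ c_i + 1 = k + n.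
HasLevel : {n : ℕ} → Config n → ℕ → Set
HasLevel {n} c k = Vec.sum c + 1 ≡ k + n

fanCount : ℕ → ℕ → ℕ
fanCount n k = listSum (map (λ r → ((n ∸ k ∸ 1) C r) * ((r + k) C r)) (upTo (n ∸ k)))

HasCount : {A : Set} → (A → Set) → ℕ → Set
HasCount {A} P m = Σ (List A) λ L → Unique L × (∀ x → (x ∈ L) ⇔ P x) × length L ≡ m

-- A configuration on the fan is recurrent iff it is stable and has no forbidden interval: two empty
-- vertices with at most one grain on every vertex between them. Adding grains and toppling never
-- create a forbidden interval and the maximal stable configuration has none, which gives necessity;
-- conversely Dhar's burning algorithm shows that every such configuration is reached from the maximal one.
-- Read from left to right, the condition is checked by a two-state automaton, so the recurrent
-- configurations of a given level are enumerated recursively, and their numbers satisfy Pascal-type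
-- recursions whose solution is the binomial sum.

module Submission where

open import Defs
open import Data.Nat using (ℕ; zero; suc; >-nonZero; _+_; _*_; _∸_; _≤_; _<_; _<ᵇ_; _≡ᵇ_; z≤n; s≤s; z<s; pred; _≤?_; _<?_)
open import Data.Nat.Properties
open import Algebra.Properties.CommutativeSemigroup +-commutativeSemigroup using (xy∙z≈xz∙y; interchange)
open import Data.Nat.Combinatorics using (_C_; nCn≡1; nCk+nC[k+1]≡[n+1]C[k+1]; k>n⇒nCk≡0)
open import Data.Nat.ListAction using () renaming (sum to listSum)
open import Data.Bool using (Bool; true; false; if_then_else_; _∨_; T)
open import Data.Bool.Properties using (∨-zeroʳ)
open import Data.Fin as Fin using (Fin; toℕ; fromℕ<)
import Data.Fin.Properties as Finₚ
open import Data.Vec as Vec using (Vec; []; _∷_; lookup; tabulate; head)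
import Data.Vec.Properties as Vecₚ
open import Data.List as List using (List; []; _∷_; _++_; applyUpTo; length)
open import Data.List.Properties using (length-++; length-map; map-applyUpTo)
open import Data.List.Membership.Propositional using (_∈_)
open import Data.List.Membership.Propositional.Properties using (∈-++⁻; ∈-++⁺ˡ; ∈-++⁺ʳ; ∈-map⁺; ∈-map⁻)
open import Data.List.Relation.Unary.Any using (here)
open import Data.List.Relation.Unary.Unique.Propositional using (Unique)
import Data.List.Relation.Unary.Unique.Propositional.Properties as Uniqueₚ
import Data.List.Relation.Unary.All as All
import Data.List.Relation.Unary.AllPairs as AllPairs
open import Data.Product using (Σ; ∃; _×_; _,_; proj₁)
open import Data.Sum using (_⊎_; inj₁; inj₂; [_,_]′)
open import Data.Empty using (⊥; ⊥-elim)
open import Data.Unit using (⊤; tt)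
open import Function using (_∘_)
open import Function.Bundles using (_⇔_; mk⇔; Equivalence)
open import Function.Properties.Equivalence using () renaming (trans to ⇔-trans; sym to ⇔-sym)
open import Relation.Nullary using (¬_; Dec; yes; no)
open import Relation.Nullary.Decidable using (_→-dec_)
open import Relation.Binary.Definitions using (tri<; tri≈; tri>)
open import Relation.Binary.PropositionalEquality
open import Relation.Binary.Construct.Closure.ReflexiveTransitive using (Star; ε; _◅_; _◅◅_)

bit : Bool → ℕ
bit b = if b then 1 else 0

bit≤1 : ∀ b → bit b ≤ 1
bit≤1 true = ≤-refl
bit≤1 false = z≤n

≡⇒≡ᵇ≡true : ∀ {m n} → m ≡ n → (m ≡ᵇ n) ≡ true
≡⇒≡ᵇ≡true {zero} refl = refl
≡⇒≡ᵇ≡true {suc m} refl = ≡⇒≡ᵇ≡true {m} refl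

≢⇒≡ᵇ≡false : ∀ {m n} → m ≢ n → (m ≡ᵇ n) ≡ false
≢⇒≡ᵇ≡false {zero} {zero} m≢n = ⊥-elim (m≢n refl)
≢⇒≡ᵇ≡false {zero} {suc n} m≢n = refl
≢⇒≡ᵇ≡false {suc m} {zero} m≢n = refl
≢⇒≡ᵇ≡false {suc m} {suc n} m≢n = ≢⇒≡ᵇ≡false (m≢n ∘ cong suc)

≡ᵇ≡true⇒≡ : ∀ {m n} → (m ≡ᵇ n) ≡ true → m ≡ n
≡ᵇ≡true⇒≡ {m} {n} e = ≡ᵇ⇒≡ m n (subst T (sym e) tt)

<⇒<ᵇ≡true : ∀ {m n} → m < n → (m <ᵇ n) ≡ true
<⇒<ᵇ≡true {zero} {suc n} _ = refl
<⇒<ᵇ≡true {suc m} {suc n} (s≤s m<n) = <⇒<ᵇ≡true m<n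

≮⇒<ᵇ≡false : ∀ {m n} → ¬ m < n → (m <ᵇ n) ≡ false
≮⇒<ᵇ≡false {m} {zero} _ = refl
≮⇒<ᵇ≡false {zero} {suc n} m≮n = ⊥-elim (m≮n z<s)
≮⇒<ᵇ≡false {suc m} {suc n} m≮n = ≮⇒<ᵇ≡false (λ m<n → m≮n (s≤s m<n))

<ᵇ≡true⇒< : ∀ {m n} → (m <ᵇ n) ≡ true → m < n
<ᵇ≡true⇒< {m} {n} e = <ᵇ⇒< m n (subst T (sym e) tt)

-- 0 beyond the last vertex; intervals of the path are easier to handle on ℕ than on Fin n.
at : ∀ {m} → Vec ℕ m → ℕ → ℕ
at [] _ = 0
at (x ∷ xs) zero = x
at (x ∷ xs) (suc t) = at xs t

lookup≡at : ∀ {m} (c : Vec ℕ m) (i : Fin m) → lookup c i ≡ at c (toℕ i)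
lookup≡at (x ∷ c) Fin.zero = refl
lookup≡at (x ∷ c) (Fin.suc i) = lookup≡at c i

at≡lookup-fromℕ< : ∀ {m} (c : Vec ℕ m) {t} (t<m : t < m) → at c t ≡ lookup c (fromℕ< t<m)
at≡lookup-fromℕ< c t<m = trans (cong (at c) (sym (Finₚ.toℕ-fromℕ< t<m))) (sym (lookup≡at c _))

lookup-ext : ∀ {m} {u v : Vec ℕ m} → (∀ i → lookup u i ≡ lookup v i) → u ≡ v
lookup-ext {u = u} {v} h = trans (sym (Vecₚ.tabulate∘lookup u)) (trans (Vecₚ.tabulate-cong h) (Vecₚ.tabulate∘lookup v))

degAt : ℕ → ℕ → ℕ
degAt n t = suc (bit (0 <ᵇ t) + bit (suc t <ᵇ n))

CanTopple : ∀ {n} → Fin n → Config n → Set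
CanTopple i c = deg i ≤ lookup c i

stable⇒¬canTopple : ∀ {n} {c : Config n} {i} → Stable c → ¬ CanTopple i c
stable⇒¬canTopple {i = i} st = <⇒≱ (st i)

stable-or-canTopple : ∀ {n} (c : Config n) → Stable c ⊎ Σ (Fin n) λ i → CanTopple i c
stable-or-canTopple c with Finₚ.any? (λ i → deg i ≤? lookup c i)
... | yes p = inj₂ p
... | no ¬p = inj₁ (λ i → ≰⇒> (λ le → ¬p (i , le)))

lookup-topple : ∀ {n} (i j : Fin n) (c : Config n) →
  lookup (topple i c) j ≡ (lookup c j ∸ (if toℕ j ≡ᵇ toℕ i then deg i else 0)) + bit (adjB i j)
lookup-topple i j c = Vecₚ.lookup∘tabulate _ j

adjB-irrefl : ∀ {n} (i : Fin n) → adjB i i ≡ false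
adjB-irrefl i rewrite ≢⇒≡ᵇ≡false {suc (toℕ i)} {toℕ i} 1+n≢n = refl

≢⇒toℕ-≡ᵇ≡false : ∀ {n} {i j : Fin n} → i ≢ j → (toℕ i ≡ᵇ toℕ j) ≡ false
≢⇒toℕ-≡ᵇ≡false i≢j = ≢⇒≡ᵇ≡false (λ e → i≢j (Finₚ.toℕ-injective e))

canTopple-topple : ∀ {n} {i j : Fin n} {c : Config n} → i ≢ j → CanTopple i c → CanTopple i (topple j c)
canTopple-topple {i = i} {j} {c} i≢j ti rewrite lookup-topple j i c | ≢⇒toℕ-≡ᵇ≡false i≢j =
  ≤-trans ti (m≤m+n (lookup c i) _)

topple-comm : ∀ {n} (i j : Fin n) (c : Config n) → i ≢ j → CanTopple i c → CanTopple j c →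
  topple i (topple j c) ≡ topple j (topple i c)
topple-comm i j c i≢j ti tj = lookup-ext pointwise
  where
  lose-then-gain : ∀ x a d → d ≤ x → ((x + a) ∸ d) + 0 ≡ ((x ∸ d) + 0) + a
  lose-then-gain x a d d≤x rewrite +-identityʳ (x + a ∸ d) | +-identityʳ (x ∸ d) = +-∸-comm a d≤x
  pointwise : ∀ k → lookup (topple i (topple j c)) k ≡ lookup (topple j (topple i c)) k
  pointwise k rewrite lookup-topple i k (topple j c) | lookup-topple j k c
    | lookup-topple j k (topple i c) | lookup-topple i k c with k Fin.≟ i | k Fin.≟ j
  ... | yes refl | yes refl = ⊥-elim (i≢j refl)
  ... | yes refl | no k≢j rewrite ≡⇒≡ᵇ≡true {toℕ k} refl | ≢⇒toℕ-≡ᵇ≡false k≢j | adjB-irrefl k =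
    lose-then-gain (lookup c k) _ (deg k) ti
  ... | no k≢i | yes refl rewrite ≡⇒≡ᵇ≡true {toℕ k} refl | ≢⇒toℕ-≡ᵇ≡false k≢i | adjB-irrefl k =
    sym (lose-then-gain (lookup c k) _ (deg k) tj)
  ... | no k≢i | no k≢j rewrite ≢⇒toℕ-≡ᵇ≡false k≢i | ≢⇒toℕ-≡ᵇ≡false k≢j =
    xy∙z≈xz∙y (lookup c k) (bit (adjB j k)) (bit (adjB i k))

data _⟶[_]_ {n : ℕ} : Config n → ℕ → Config n → Set where
  done : ∀ {c} → c ⟶[ 0 ] c
  step : ∀ {m c d} (i : Fin n) → CanTopple i c → topple i c ⟶[ m ] d → c ⟶[ suc m ] d

⟶[]⇒⟶* : ∀ {n m} {c d : Config n} → c ⟶[ m ] d → c ⟶* d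
⟶[]⇒⟶* done = done
⟶[]⇒⟶* (step i t s) = step i t (⟶[]⇒⟶* s)

⟶*⇒⟶[] : ∀ {n} {c d : Config n} → c ⟶* d → ∃ λ m → c ⟶[ m ] d
⟶*⇒⟶[] done = 0 , done
⟶*⇒⟶[] (step i t r) = let (m , s) = ⟶*⇒⟶[] r in suc m , step i t s

⟶*-trans : ∀ {n} {a b c : Config n} → a ⟶* b → b ⟶* c → a ⟶* c
⟶*-trans done q = q
⟶*-trans (step i t r) q = step i t (⟶*-trans r q)

stable-⟶*⇒≡ : ∀ {n} {c d : Config n} → Stable c → c ⟶* d → c ≡ d
stable-⟶*⇒≡ sc done = refl
stable-⟶*⇒≡ {c = c} sc (step i t r) = ⊥-elim (stable⇒¬canTopple {c = c} sc t)

-- A toppleable vertex stays toppleable until it is toppled, so a toppling sequence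
-- ending in a stable configuration topples it somewhere; commutativity moves that toppling to the front.
topple-first : ∀ {n m} {c d : Config n} (i : Fin n) → c ⟶[ suc m ] d → Stable d → CanTopple i c →
  topple i c ⟶[ m ] d
topple-first-instead : ∀ {n m} {c d : Config n} (i j : Fin n) → i ≢ j → CanTopple i c → CanTopple j c →
  topple j c ⟶[ m ] d → Stable d → topple i c ⟶[ m ] d

topple-first {c = c} i (step j tj s) sd ti with j Fin.≟ i
... | yes refl = s
... | no j≢i = topple-first-instead {c = c} i j (λ e → j≢i (sym e)) ti tj s sd

topple-first-instead {c = c} i j i≢j ti tj done sd =
  ⊥-elim (stable⇒¬canTopple {c = topple j c} sd (canTopple-topple {c = c} i≢j ti))
topple-first-instead {c = c} i j i≢j ti tj s@(step _ _ _) sd =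
  step j (canTopple-topple {c = c} (λ e → i≢j (sym e)) tj)
    (subst (_⟶[ _ ] _) (topple-comm i j c i≢j ti tj)
      (topple-first {c = topple j c} i s sd (canTopple-topple {c = c} i≢j ti)))

lookup-addGrain-≡ : ∀ {n} (g : Fin n) (c : Config n) → lookup (addGrain g c) g ≡ suc (lookup c g)
lookup-addGrain-≡ g c = Vecₚ.lookup∘updateAt g c

lookup-addGrain-≢ : ∀ {n} (g k : Fin n) (c : Config n) → k ≢ g → lookup (addGrain g c) k ≡ lookup c k
lookup-addGrain-≢ g k c k≢g = Vecₚ.lookup∘updateAt′ k g k≢g c

lookup-≤-addGrain : ∀ {n} (g k : Fin n) (c : Config n) → lookup c k ≤ lookup (addGrain g c) k
lookup-≤-addGrain g k c with k Fin.≟ g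
... | yes refl rewrite lookup-addGrain-≡ g c = n≤1+n _
... | no k≢g rewrite lookup-addGrain-≢ g k c k≢g = ≤-refl

topple-addGrain : ∀ {n} (j g : Fin n) (c : Config n) → CanTopple j c →
  topple j (addGrain g c) ≡ addGrain g (topple j c)
topple-addGrain j g c tj = lookup-ext pointwise
  where
  loss≤ : ∀ k → (if toℕ k ≡ᵇ toℕ j then deg j else 0) ≤ lookup c k
  loss≤ k with toℕ k ≡ᵇ toℕ j in eq
  ... | false = z≤n
  ... | true with Finₚ.toℕ-injective {i = k} {j = j} (≡ᵇ≡true⇒≡ eq)
  ... | refl = tj
  pointwise : ∀ k → lookup (topple j (addGrain g c)) k ≡ lookup (addGrain g (topple j c)) k
  pointwise k rewrite lookup-topple j k (addGrain g c) with k Fin.≟ g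
  ... | yes refl rewrite lookup-addGrain-≡ k c | lookup-addGrain-≡ k (topple j c) | lookup-topple j k c
                       | +-∸-assoc 1 (loss≤ k) = refl
  ... | no k≢g rewrite lookup-addGrain-≢ g k c k≢g | lookup-addGrain-≢ g k (topple j c) k≢g
                     | lookup-topple j k c = refl

addGrains : ∀ {n} → List (Fin n) → Config n → Config n
addGrains [] c = c
addGrains (g ∷ gs) c = addGrains gs (addGrain g c)

addGrains-++ : ∀ {n} (gs hs : List (Fin n)) (c : Config n) → addGrains (gs ++ hs) c ≡ addGrains hs (addGrains gs c)
addGrains-++ [] hs c = refl
addGrains-++ (g ∷ gs) hs c = addGrains-++ gs hs (addGrain g c)

lookup-≤-addGrains : ∀ {n} (gs : List (Fin n)) (k : Fin n) (c : Config n) → lookup c k ≤ lookup (addGrains gs c) k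
lookup-≤-addGrains [] k c = ≤-refl
lookup-≤-addGrains (g ∷ gs) k c = ≤-trans (lookup-≤-addGrain g k c) (lookup-≤-addGrains gs k (addGrain g c))

canTopple-addGrains : ∀ {n} (gs : List (Fin n)) {j : Fin n} {c : Config n} → CanTopple j c → CanTopple j (addGrains gs c)
canTopple-addGrains gs {j} {c} tj = ≤-trans tj (lookup-≤-addGrains gs j c)

topple-addGrains : ∀ {n} (j : Fin n) (gs : List (Fin n)) (c : Config n) → CanTopple j c →
  topple j (addGrains gs c) ≡ addGrains gs (topple j c)
topple-addGrains j [] c tj = refl
topple-addGrains j (g ∷ gs) c tj =
  trans (topple-addGrains j gs (addGrain g c) (≤-trans tj (lookup-≤-addGrain g j c)))
        (cong (addGrains gs) (topple-addGrain j g c tj))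

addGrains-⟶* : ∀ {n} (gs : List (Fin n)) {a b : Config n} → a ⟶* b → addGrains gs a ⟶* addGrains gs b
addGrains-⟶* gs done = done
addGrains-⟶* gs {a} (step i ti r) =
  step i (canTopple-addGrains gs ti) (subst (_⟶* _) (sym (topple-addGrains i gs a ti)) (addGrains-⟶* gs r))

-- A toppling available in v is available in addGrains gs v, and by topple-first it can be done first.
stabilise-before-adding : ∀ {n} m (gs : List (Fin n)) (v : Config n) {b : Config n} →
  addGrains gs v ⟶[ m ] b → Stable b →
  Σ (Config n) λ w → (v ⟶* w) × Stable w × (addGrains gs w ⟶* b)
stabilise-before-adding m gs v s sb with stable-or-canTopple v
... | inj₁ sv = v , done , sv , ⟶[]⇒⟶* s
stabilise-before-adding zero gs v done sb | inj₂ (j , tj) =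
  ⊥-elim (stable⇒¬canTopple {c = addGrains gs v} sb (canTopple-addGrains gs tj))
stabilise-before-adding (suc m) gs v s sb | inj₂ (j , tj) =
  let s′ = subst (_⟶[ m ] _) (topple-addGrains j gs v tj)
                 (topple-first {c = addGrains gs v} j s sb (canTopple-addGrains gs tj))
      (w , v⟶w , sw , gs⟶b) = stabilise-before-adding m gs (topple j v) s′ sb
  in w , step j tj v⟶w , sw , gs⟶b

addGrains-⟶*⇒chain : ∀ {n} (gs : List (Fin n)) {s b : Config n} → Stable s → Stable b →
  addGrains gs s ⟶* b → Star Step s b
addGrains-⟶*⇒chain [] {s} ss sb r rewrite stable-⟶*⇒≡ {c = s} ss r = ε
addGrains-⟶*⇒chain (g ∷ gs) {s} ss sb r =
  let (m , s′) = ⟶*⇒⟶[] r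
      (w , r₁ , sw , r₂) = stabilise-before-adding m gs (addGrain g s) s′ sb
  in (ss , g , r₁ , sw) ◅ addGrains-⟶*⇒chain gs sw sb r₂

chain-stable : ∀ {n} {s d : Config n} → Stable s → Star Step s d → Stable d
chain-stable ss ε = ss
chain-stable ss ((_ , _ , _ , sw) ◅ p) = chain-stable sw p

grainList : ∀ {n} → (Fin n → ℕ) → List (Fin n)
grainList {zero} f = []
grainList {suc n} f = List.replicate (f Fin.zero) Fin.zero ++ List.map Fin.suc (grainList (f ∘ Fin.suc))

addGrains-zeros : ∀ {n} m x (c : Config n) → addGrains (List.replicate m Fin.zero) (x ∷ c) ≡ (m + x) ∷ c
addGrains-zeros zero x c = refl
addGrains-zeros (suc m) x c = trans (addGrains-zeros m (suc x) c) (cong (_∷ c) (+-suc m x))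

addGrains-map-suc : ∀ {n} (gs : List (Fin n)) x (c : Config n) → addGrains (List.map Fin.suc gs) (x ∷ c) ≡ x ∷ addGrains gs c
addGrains-map-suc [] x c = refl
addGrains-map-suc (g ∷ gs) x c = addGrains-map-suc gs x (addGrain g c)

lookup-addGrains-grainList : ∀ {n} (f : Fin n → ℕ) (c : Config n) k → lookup (addGrains (grainList f) c) k ≡ lookup c k + f k
lookup-addGrains-grainList {suc n} f (x ∷ c) k
  rewrite addGrains-++ (List.replicate (f Fin.zero) Fin.zero) (List.map Fin.suc (grainList (f ∘ Fin.suc))) (x ∷ c)
        | addGrains-zeros (f Fin.zero) x c
        | addGrains-map-suc (grainList (f ∘ Fin.suc)) (f Fin.zero + x) c
  with k
... | Fin.zero = +-comm (f Fin.zero) x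
... | Fin.suc k = lookup-addGrains-grainList (f ∘ Fin.suc) c k

maxStable : ∀ {n} → Config n
maxStable = tabulate (λ i → pred (deg i))

lookup-maxStable : ∀ {n} (i : Fin n) → lookup maxStable i ≡ pred (deg i)
lookup-maxStable i = Vecₚ.lookup∘tabulate _ i

maxStable-stable : ∀ {n} → Stable (maxStable {n})
maxStable-stable i rewrite lookup-maxStable i = ≤-refl

chain-to-maxStable : ∀ {n} {c : Config n} → Stable c → Star Step c maxStable
chain-to-maxStable {n} {c} sc = addGrains-⟶*⇒chain missing sc maxStable-stable (subst (_⟶* maxStable) fills done)
  where
  missing : List (Fin n)
  missing = grainList (λ i → pred (deg i) ∸ lookup c i)
  fills : maxStable ≡ addGrains missing c
  fills = lookup-ext λ k → sym (begin
    lookup (addGrains missing c) k   ≡⟨ lookup-addGrains-grainList _ c k ⟩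
    lookup c k + (pred (deg k) ∸ lookup c k) ≡⟨ m+[n∸m]≡n (≤-pred (sc k)) ⟩
    pred (deg k)                      ≡⟨ lookup-maxStable k ⟨
    lookup maxStable k ∎)
    where open ≡-Reasoning

-- Forbidden intervals

ForbiddenIn : ℕ → (ℕ → ℕ) → ℕ → ℕ → Set
ForbiddenIn n f a b = (a < b) × (b < n) × (f a ≡ 0) × (f b ≡ 0) × (∀ v → a < v → v < b → f v ≤ 1)

NoForbidden : ∀ {n} → Config n → Set
NoForbidden {n} c = ∀ a b → ¬ ForbiddenIn n (at c) a b

-- f is the configuration before and g after toppling t: t only loses grains and its neighbours gain one,
-- so a forbidden interval of g either avoids t or can be cut at a neighbour of t into one of f.
module ForbiddenBeforeToppling (n : ℕ) (f g : ℕ → ℕ) (t : ℕ)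
  (≤-elsewhere : ∀ v → v < n → v ≢ t → f v ≤ g v)
  (<-right : ∀ v → v < n → suc t ≡ v → suc (f v) ≤ g v)
  (<-left : ∀ v → v < n → suc v ≡ t → suc (f v) ≤ g v) where

  1+≤1⇒≡0 : ∀ {x} → suc x ≤ 1 → x ≡ 0
  1+≤1⇒≡0 (s≤s x≤0) = n≤0⇒n≡0 x≤0

  avoiding : ∀ a b → ForbiddenIn n g a b → (∀ v → a ≤ v → v ≤ b → v ≢ t) → ForbiddenIn n f a b
  avoiding a b (a<b , b<n , ga , gb , mid) avoids = a<b , b<n ,
    n≤0⇒n≡0 (subst (_ ≤_) ga (≤-elsewhere a (<-trans a<b b<n) (avoids a ≤-refl (<⇒≤ a<b)))) ,
    n≤0⇒n≡0 (subst (_ ≤_) gb (≤-elsewhere b b<n (avoids b (<⇒≤ a<b) ≤-refl))) ,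
    λ v a<v v<b → ≤-trans (≤-elsewhere v (<-trans v<b b<n) (avoids v (<⇒≤ a<v) (<⇒≤ v<b))) (mid v a<v v<b)

  cut-left-of : ∀ t′ → suc t′ ≡ t → ∀ a b → ForbiddenIn n g a b → a < suc t′ → suc t′ ≤ b →
    ∃ λ a′ → ∃ λ b′ → ForbiddenIn n f a′ b′
  cut-left-of t′ e a b (a<b , b<n , ga , gb , mid) a<t t≤b with a ≟ t′
  ... | yes refl = ⊥-elim (1+n≢0 (n≤0⇒n≡0 (subst (_ ≤_) ga (<-left a (<-trans a<b b<n) e))))
  ... | no a≢t′ = a , t′ , a<t′ , t′<n ,
      n≤0⇒n≡0 (subst (_ ≤_) ga (≤-elsewhere a (<-trans a<b b<n) (λ a≡t → <-irrefl (trans a≡t (sym e)) a<t))) ,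
      1+≤1⇒≡0 (≤-trans (<-left t′ t′<n e) (mid t′ a<t′ t′<b)) ,
      λ v a<v v<t′ → ≤-trans (≤-elsewhere v (<-trans (<-trans v<t′ t′<b) b<n)
                                (λ v≡t → <-irrefl (trans v≡t (sym e)) (<-trans v<t′ (n<1+n t′))))
                             (mid v a<v (<-trans v<t′ t′<b))
    where
    a<t′ : a < t′
    a<t′ = ≤∧≢⇒< (≤-pred a<t) a≢t′
    t′<b : t′ < b
    t′<b = <-≤-trans (n<1+n t′) t≤b
    t′<n : t′ < n
    t′<n = <-trans t′<b b<n

  cut-left : ∀ a b → ForbiddenIn n g a b → a < t → t ≤ b → ∃ λ a′ → ∃ λ b′ → ForbiddenIn n f a′ b′
  cut-left a b F a<t t≤b =
    cut-left-of (pred t) e a b F (subst (a <_) (sym e) a<t) (subst (_≤ b) (sym e) t≤b)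
    where
    e : suc (pred t) ≡ t
    e = suc-pred t {{>-nonZero (≤-<-trans z≤n a<t)}}

  cut-right : ∀ b → ForbiddenIn n g t b → ∃ λ a′ → ∃ λ b′ → ForbiddenIn n f a′ b′
  cut-right b (t<b , b<n , gt , gb , mid) with suc t ≟ b
  ... | yes refl = ⊥-elim (1+n≢0 (n≤0⇒n≡0 (subst (_ ≤_) gb (<-right (suc t) b<n refl))))
  ... | no 1+t≢b = suc t , b , 1+t<b , b<n ,
      1+≤1⇒≡0 (≤-trans (<-right (suc t) (<-trans 1+t<b b<n) refl) (mid (suc t) ≤-refl 1+t<b)) ,
      n≤0⇒n≡0 (subst (_ ≤_) gb (≤-elsewhere b b<n (λ b≡t → <-irrefl (sym b≡t) t<b))) ,
      λ v 1+t<v v<b → ≤-trans (≤-elsewhere v (<-trans v<b b<n) (λ v≡t → <-irrefl (sym v≡t) (<-trans (n<1+n t) 1+t<v)))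
                               (mid v (<-trans (n<1+n t) 1+t<v) v<b)
    where
    1+t<b : suc t < b
    1+t<b = ≤∧≢⇒< t<b 1+t≢b

  forbidden-before : ∀ a b → ForbiddenIn n g a b → ∃ λ a′ → ∃ λ b′ → ForbiddenIn n f a′ b′
  forbidden-before a b F@(a<b , _) with <-cmp t a
  ... | tri< t<a _ _ = a , b , avoiding a b F (λ v a≤v _ v≡t → <-irrefl (sym v≡t) (<-≤-trans t<a a≤v))
  ... | tri≈ _ refl _ = cut-right b F
  ... | tri> _ _ a<t with <-cmp b t
  ...   | tri< b<t _ _ = a , b , avoiding a b F (λ v _ v≤b v≡t → <-irrefl v≡t (≤-<-trans v≤b b<t))
  ...   | tri≈ _ b≡t _ = cut-left a b F a<t (≤-reflexive (sym b≡t))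
  ...   | tri> _ _ t<b = cut-left a b F a<t (<⇒≤ t<b)

at-topple : ∀ {n} (i : Fin n) (c : Config n) {v} → v < n →
  at (topple i c) v ≡ (at c v ∸ (if v ≡ᵇ toℕ i then deg i else 0)) + bit ((suc (toℕ i) ≡ᵇ v) ∨ (suc v ≡ᵇ toℕ i))
at-topple {n} i c {v} v<n = begin
  at (topple i c) v                   ≡⟨ at≡lookup-fromℕ< (topple i c) v<n ⟩
  lookup (topple i c) j               ≡⟨ lookup-topple i j c ⟩
  after (lookup c j) (toℕ j)          ≡⟨ cong (λ x → after x (toℕ j)) (lookup≡at c j) ⟩
  after (at c (toℕ j)) (toℕ j)        ≡⟨ cong (λ w → after (at c w) w) (Finₚ.toℕ-fromℕ< v<n) ⟩
  after (at c v) v                    ∎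
  where
  open ≡-Reasoning
  j : Fin n
  j = fromℕ< v<n
  after : ℕ → ℕ → ℕ
  after x w = (x ∸ (if w ≡ᵇ toℕ i then deg i else 0)) + bit ((suc (toℕ i) ≡ᵇ w) ∨ (suc w ≡ᵇ toℕ i))

noForbidden-topple : ∀ {n} (i : Fin n) (c : Config n) → NoForbidden c → NoForbidden (topple i c)
noForbidden-topple {n} i c nf a b F =
  let (a′ , b′ , F′) = forbidden-before a b F in nf a′ b′ F′
  where
  ≤-elsewhere : ∀ v → v < n → v ≢ toℕ i → at c v ≤ at (topple i c) v
  ≤-elsewhere v v<n v≢i rewrite at-topple i c v<n | ≢⇒≡ᵇ≡false v≢i = m≤m+n _ _
  <-right : ∀ v → v < n → suc (toℕ i) ≡ v → suc (at c v) ≤ at (topple i c) v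
  <-right v v<n e rewrite at-topple i c v<n | ≢⇒≡ᵇ≡false {v} {toℕ i} (λ v≡i → 1+n≢n (trans e v≡i))
                        | ≡⇒≡ᵇ≡true e = ≤-reflexive (+-comm 1 _)
  <-left : ∀ v → v < n → suc v ≡ toℕ i → suc (at c v) ≤ at (topple i c) v
  <-left v v<n e rewrite at-topple i c v<n | ≢⇒≡ᵇ≡false {v} {toℕ i} (λ v≡i → 1+n≢n (trans e (sym v≡i)))
                       | ≡⇒≡ᵇ≡true e | ∨-zeroʳ (suc (toℕ i) ≡ᵇ v) = ≤-reflexive (+-comm 1 _)
  open ForbiddenBeforeToppling n (at c) (at (topple i c)) (toℕ i) ≤-elsewhere <-right <-left

at-≤-addGrain : ∀ {m} (g : Fin m) (c : Vec ℕ m) v → at c v ≤ at (addGrain g c) v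
at-≤-addGrain Fin.zero (x ∷ c) zero = n≤1+n x
at-≤-addGrain Fin.zero (x ∷ c) (suc v) = ≤-refl
at-≤-addGrain (Fin.suc g) (x ∷ c) zero = ≤-refl
at-≤-addGrain (Fin.suc g) (x ∷ c) (suc v) = at-≤-addGrain g c v

noForbidden-addGrain : ∀ {n} (g : Fin n) (c : Config n) → NoForbidden c → NoForbidden (addGrain g c)
noForbidden-addGrain g c nf a b (a<b , b<n , ga , gb , mid) =
  nf a b (a<b , b<n , n≤0⇒n≡0 (subst (_ ≤_) ga (at-≤-addGrain g c a)) ,
          n≤0⇒n≡0 (subst (_ ≤_) gb (at-≤-addGrain g c b)) ,
          λ v a<v v<b → ≤-trans (at-≤-addGrain g c v) (mid v a<v v<b))

noForbidden-⟶* : ∀ {n} {c d : Config n} → NoForbidden c → c ⟶* d → NoForbidden d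
noForbidden-⟶* nf done = nf
noForbidden-⟶* {c = c} nf (step i _ r) = noForbidden-⟶* (noForbidden-topple i c nf) r

noForbidden-chain : ∀ {n} {c d : Config n} → NoForbidden c → Star Step c d → NoForbidden d
noForbidden-chain nf ε = nf
noForbidden-chain {c = c} nf ((_ , g , r , _) ◅ p) = noForbidden-chain (noForbidden-⟶* (noForbidden-addGrain g c nf) r) p

at-maxStable : ∀ {n} {v} (v<n : v < n) → at (maxStable {n}) v ≡ bit (0 <ᵇ v) + bit (suc v <ᵇ n)
at-maxStable {n} v<n =
  trans (at≡lookup-fromℕ< maxStable v<n)
        (trans (lookup-maxStable (fromℕ< v<n)) (cong (λ t → bit (0 <ᵇ t) + bit (suc t <ᵇ n)) (Finₚ.toℕ-fromℕ< v<n)))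

noForbidden-maxStable : ∀ {n} → NoForbidden (maxStable {n})
noForbidden-maxStable {n} a b (a<b , b<n , ga , _)
  rewrite at-maxStable {n} (<-trans a<b b<n) | <⇒<ᵇ≡true (<-≤-trans (s≤s a<b) b<n) = 1+n≢0 (trans (+-comm 1 _) ga)

-- Dhar's burning algorithm

bounded-search : (P : ℕ → Set) → (∀ v → Dec (P v)) → ∀ m → (∀ v → v < m → P v) ⊎ (∃ λ v → v < m × ¬ P v)
bounded-search P P? zero = inj₁ (λ v ())
bounded-search P P? (suc m) with bounded-search P P? m | P? m
... | inj₂ (v , v<m , ¬pv) | _ = inj₂ (v , m<n⇒m<1+n v<m , ¬pv)
... | inj₁ all | yes pm = inj₁ λ v v<1+m → [ all v , (λ v≡m → subst P (sym v≡m) pm) ]′ (m≤n⇒m<n∨m≡n (≤-pred v<1+m))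
... | inj₁ all | no ¬pm = inj₂ (m , ≤-refl , ¬pm)

-- A set B ⊆ ℕ of burnt vertices stands for the configuration obtained from c + (1,…,1) by toppling
-- every vertex of B once; (1,…,1) is the burning configuration, as every vertex is joined to the sink.
-- While some vertex is unburnt, the absence of forbidden intervals lets one more unburnt vertex topple,
-- and once all are burnt the configuration is c again.
module Burning {n : ℕ} (c : Config n) (nf : NoForbidden c) where

  Burnt : Set
  Burnt = ℕ → Bool

  burntLeft burntRight burntNeighbours : Burnt → ℕ → ℕ
  burntLeft B t = if 0 <ᵇ t then bit (B (pred t)) else 0
  burntRight B t = if suc t <ᵇ n then bit (B (suc t)) else 0
  burntNeighbours B t = burntLeft B t + burntRight B t

  gathered : Burnt → ℕ → ℕ
  gathered B t = at c t + 1 + burntNeighbours B t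

  afterBurning : Burnt → ℕ → ℕ
  afterBurning B t = gathered B t ∸ (if B t then degAt n t else 0)

  burningConfig : Burnt → Config n
  burningConfig B = tabulate (afterBurning B ∘ toℕ)

  at-burningConfig : ∀ B {t} (t<n : t < n) → at (burningConfig B) t ≡ afterBurning B t
  at-burningConfig B t<n =
    trans (at≡lookup-fromℕ< (burningConfig B) t<n)
          (trans (Vecₚ.lookup∘tabulate _ (fromℕ< t<n)) (cong (afterBurning B) (Finₚ.toℕ-fromℕ< t<n)))

  LegalBurn : Burnt → Set
  LegalBurn B = ∀ t → t < n → B t ≡ true → degAt n t ≤ gathered B t

  burn : Burnt → ℕ → Burnt
  burn B v s = if s ≡ᵇ v then true else B s

  burn-≢ : ∀ B {v s} → s ≢ v → burn B v s ≡ B s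
  burn-≢ B s≢v rewrite ≢⇒≡ᵇ≡false s≢v = refl

  burn-≡ : ∀ B v → burn B v v ≡ true
  burn-≡ B v rewrite ≡⇒≡ᵇ≡true {v} refl = refl

  burntLeft-burn : ∀ B {v t} → suc v ≢ t → burntLeft (burn B v) t ≡ burntLeft B t
  burntLeft-burn B {v} {zero} _ = refl
  burntLeft-burn B {v} {suc t} 1+v≢1+t rewrite burn-≢ B {v} {t} (λ t≡v → 1+v≢1+t (cong suc (sym t≡v))) = refl

  burntRight-burn : ∀ B {v t} → suc t ≢ v → burntRight (burn B v) t ≡ burntRight B t
  burntRight-burn B {v} {t} 1+t≢v with suc t <ᵇ n
  ... | false = refl
  ... | true rewrite burn-≢ B {v} {suc t} 1+t≢v = refl

  loss≤gathered : ∀ B → LegalBurn B → ∀ t → t < n → (if B t then degAt n t else 0) ≤ gathered B t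
  loss≤gathered B legal t t<n with B t in e
  ... | true = legal t t<n e
  ... | false = z≤n

  one-more-left : ∀ x R δ → δ ≤ x + (0 + R) → ((x + (0 + R)) ∸ δ) + 1 ≡ (x + (1 + R)) ∸ δ
  one-more-left x R δ le = trans (sym (+-∸-comm 1 le)) (cong (_∸ δ) (trans (+-assoc x R 1) (cong (x +_) (+-comm R 1))))

  one-more-right : ∀ x L δ → δ ≤ x + (L + 0) → ((x + (L + 0)) ∸ δ) + 1 ≡ (x + (L + 1)) ∸ δ
  one-more-right x L δ le =
    trans (sym (+-∸-comm 1 le)) (cong (_∸ δ) (trans (+-assoc x (L + 0) 1) (cong (λ z → x + (z + 1)) (+-identityʳ L))))

  ToppledAt : Burnt → ℕ → ℕ → Set
  ToppledAt B v t =
    (afterBurning B t ∸ (if t ≡ᵇ v then degAt n v else 0)) + bit ((suc v ≡ᵇ t) ∨ (suc t ≡ᵇ v)) ≡ afterBurning (burn B v) t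

  toppledAt-self : ∀ B t → B t ≡ false → ToppledAt B t t
  toppledAt-self B t bt rewrite ≡⇒≡ᵇ≡true {t} refl | ≢⇒≡ᵇ≡false {suc t} {t} 1+n≢n | bt
    | burntLeft-burn B {t} {t} 1+n≢n = +-identityʳ _

  toppledAt-right : ∀ B v → B v ≡ false → LegalBurn B → suc v < n → ToppledAt B v (suc v)
  toppledAt-right B v bv legal 1+v<n with loss≤gathered B legal (suc v) 1+v<n
  ... | le rewrite ≢⇒≡ᵇ≡false {suc v} {v} 1+n≢n | ≡⇒≡ᵇ≡true {suc v} refl | bv
    | burntRight-burn B {v} {suc v} (λ e → <-irrefl (sym e) (<-trans (n<1+n v) (n<1+n (suc v)))) =
    one-more-left _ _ _ le

  toppledAt-left : ∀ B t → B (suc t) ≡ false → LegalBurn B → suc t < n → t < n → ToppledAt B (suc t) t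
  toppledAt-left B t bv legal 1+t<n t<n with loss≤gathered B legal t t<n
  ... | le rewrite ≢⇒≡ᵇ≡false {t} {suc t} (λ e → 1+n≢n (sym e))
    | ≢⇒≡ᵇ≡false {suc (suc t)} {t} (λ e → <-irrefl (sym e) (<-trans (n<1+n t) (n<1+n (suc t))))
    | burntLeft-burn B {suc t} {t} (λ e → <-irrefl (sym e) (<-trans (n<1+n t) (n<1+n (suc t))))
    | <⇒<ᵇ≡true 1+t<n | ≡⇒≡ᵇ≡true {suc t} refl | bv =
    one-more-right (at c t + 1) (burntLeft B t) _ le

  toppledAt-elsewhere : ∀ B v t → t ≢ v → suc v ≢ t → suc t ≢ v → ToppledAt B v t
  toppledAt-elsewhere B v t t≢v 1+v≢t 1+t≢v rewrite ≢⇒≡ᵇ≡false t≢v | ≢⇒≡ᵇ≡false 1+v≢t | ≢⇒≡ᵇ≡false 1+t≢v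
    | burntLeft-burn B 1+v≢t = +-identityʳ _

  toppledAt : ∀ B v → v < n → B v ≡ false → LegalBurn B → ∀ t → t < n → ToppledAt B v t
  toppledAt B v v<n bv legal t t<n with t ≟ v | suc v ≟ t | suc t ≟ v
  ... | yes refl | _ | _ = toppledAt-self B t bv
  ... | no t≢v | yes refl | _ = toppledAt-right B v bv legal t<n
  ... | no t≢v | no 1+v≢t | yes refl = toppledAt-left B t bv legal v<n t<n
  ... | no t≢v | no 1+v≢t | no 1+t≢v = toppledAt-elsewhere B v t t≢v 1+v≢t 1+t≢v

  topple-burningConfig : ∀ B v (v<n : v < n) → B v ≡ false → LegalBurn B →
    topple (fromℕ< v<n) (burningConfig B) ≡ burningConfig (burn B v)
  topple-burningConfig B v v<n bv legal = lookup-ext λ k →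
    trans (lookup≡at (topple i (burningConfig B)) k)
          (trans (pointwise (toℕ k) (Finₚ.toℕ<n k)) (sym (lookup≡at (burningConfig (burn B v)) k)))
    where
    i : Fin n
    i = fromℕ< v<n
    pointwise : ∀ t → t < n → at (topple i (burningConfig B)) t ≡ at (burningConfig (burn B v)) t
    pointwise t t<n rewrite at-topple i (burningConfig B) t<n | at-burningConfig B t<n | Finₚ.toℕ-fromℕ< v<n
      | at-burningConfig (burn B v) t<n = toppledAt B v v<n bv legal t t<n

  bit-mono : ∀ {b b′ : Bool} → (b ≡ true → b′ ≡ true) → bit b ≤ bit b′
  bit-mono {false} _ = z≤n
  bit-mono {true} h rewrite h refl = ≤-refl

  burn-mono : ∀ B v s → B s ≡ true → burn B v s ≡ true
  burn-mono B v s bs with s ≡ᵇ v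
  ... | true = refl
  ... | false = bs

  burntNeighbours-burn : ∀ B v t → burntNeighbours B t ≤ burntNeighbours (burn B v) t
  burntNeighbours-burn B v t = +-mono-≤ left right
    where
    left : burntLeft B t ≤ burntLeft (burn B v) t
    left with 0 <ᵇ t
    ... | false = ≤-refl
    ... | true = bit-mono (burn-mono B v (pred t))
    right : burntRight B t ≤ burntRight (burn B v) t
    right with suc t <ᵇ n
    ... | false = ≤-refl
    ... | true = bit-mono (burn-mono B v (suc t))

  legal-burn : ∀ B v → B v ≡ false → LegalBurn B → degAt n v ≤ gathered B v → LegalBurn (burn B v)
  legal-burn B v bv legal top t t<n bt with t ≟ v
  ... | yes refl = ≤-trans top (+-monoʳ-≤ (at c t + 1) (burntNeighbours-burn B t t))
  ... | no t≢v = ≤-trans (legal t t<n (trans (sym (burn-≢ B t≢v)) bt)) (+-monoʳ-≤ (at c t + 1) (burntNeighbours-burn B v t))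

  unburnt : Burnt → ℕ → ℕ
  unburnt B zero = 0
  unburnt B (suc m) = unburnt B m + (if B m then 0 else 1)

  unburnt-burn-beyond : ∀ B v m → m ≤ v → unburnt (burn B v) m ≡ unburnt B m
  unburnt-burn-beyond B v zero _ = refl
  unburnt-burn-beyond B v (suc m) m<v
    rewrite burn-≢ B {v} {m} (λ m≡v → <-irrefl m≡v m<v) | unburnt-burn-beyond B v m (≤-trans (n≤1+n m) m<v) = refl

  unburnt-burn : ∀ B v m → B v ≡ false → v < m → suc (unburnt (burn B v) m) ≡ unburnt B m
  unburnt-burn B v (suc m) bv v<1+m with m ≟ v
  ... | yes refl rewrite burn-≡ B m | bv | unburnt-burn-beyond B m m ≤-refl = trans (cong suc (+-identityʳ _)) (+-comm 1 _)
  ... | no m≢v rewrite burn-≢ B m≢v =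
    cong (_+ (if B m then 0 else 1)) (unburnt-burn B v m bv (≤∧≢⇒< (≤-pred v<1+m) (λ v≡m → m≢v (sym v≡m))))

  unburnt≡0⇒burnt : ∀ B m → unburnt B m ≡ 0 → ∀ s → s < m → B s ≡ true
  unburnt≡0⇒burnt B (suc m) e s s<1+m with B m in bm
  ... | false = ⊥-elim (1+n≢0 (trans (+-comm 1 _) e))
  ... | true with m≤n⇒m<n∨m≡n (≤-pred s<1+m)
  ...   | inj₁ s<m = unburnt≡0⇒burnt B m (trans (sym (+-identityʳ _)) e) s s<m
  ...   | inj₂ refl = bm

  unburnt≢0⇒unburnt : ∀ B m u → unburnt B m ≡ suc u → ∃ λ s → s < m × B s ≡ false
  unburnt≢0⇒unburnt B (suc m) u e with B m in bm
  ... | false = m , ≤-refl , bm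
  ... | true = let (s , s<m , bs) = unburnt≢0⇒unburnt B m u (trans (sym (+-identityʳ _)) e) in s , m<n⇒m<1+n s<m , bs

  ClosedLeft ClosedRight : Burnt → ℕ → Set
  ClosedLeft B a = burntLeft B a ≡ bit (0 <ᵇ a)
  ClosedRight B b = burntRight B b ≡ bit (suc b <ᵇ n)

  UnburntRun : Burnt → ℕ → ℕ → Set
  UnburntRun B a b = ∀ r → a ≤ r → r ≤ b → B r ≡ false

  leftmost-in-run : ∀ B t → B t ≡ false → ∃ λ a → a ≤ t × UnburntRun B a t × ClosedLeft B a
  leftmost-in-run B zero bt = 0 , z≤n , (λ r 0≤r r≤0 → subst (λ z → B z ≡ false) (sym (n≤0⇒n≡0 r≤0)) bt) , refl
  leftmost-in-run B (suc t) b1+t with B t in bt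
  ... | true = suc t , ≤-refl , (λ r 1+t≤r r≤1+t → subst (λ z → B z ≡ false) (≤-antisym 1+t≤r r≤1+t) b1+t) , cong bit bt
  ... | false =
    let (a , a≤t , run , closed) = leftmost-in-run B t bt
    in a , ≤-trans a≤t (n≤1+n t) ,
       (λ r a≤r r≤1+t → [ (λ r<1+t → run r a≤r (≤-pred r<1+t)) , (λ r≡1+t → subst (λ z → B z ≡ false) (sym r≡1+t) b1+t) ]′
                          (m≤n⇒m<n∨m≡n r≤1+t)) ,
       closed

  -- fuel counts the vertices to the right of s
  rightmost-in-run : ∀ B a fuel s → a ≤ s → s + suc fuel ≡ n → UnburntRun B a s →
    ∃ λ b → a ≤ b × b < n × UnburntRun B a b × ClosedRight B b
  rightmost-in-run B a zero s a≤s e run = s , a≤s , s<n , run , closed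
    where
    s<n : s < n
    s<n = subst (s <_) e (≤-reflexive (sym (+-comm s 1)))
    closed : ClosedRight B s
    closed rewrite ≮⇒<ᵇ≡false {suc s} {n} (λ 1+s<n → <-irrefl (trans (+-comm 1 s) e) 1+s<n) = refl
  rightmost-in-run B a (suc fuel) s a≤s e run with B (suc s) in b1+s
  ... | true = s , a≤s , <-trans (n<1+n s) 1+s<n , run , closed
    where
    1+s<n : suc s < n
    1+s<n = subst (suc s <_) e
      (subst (suc (suc s) ≤_) (sym (trans (+-suc s (suc fuel)) (cong suc (+-suc s fuel)))) (s≤s (s≤s (m≤m+n s fuel))))
    closed : ClosedRight B s
    closed rewrite <⇒<ᵇ≡true 1+s<n | b1+s = refl
  ... | false = rightmost-in-run B a fuel (suc s) (≤-trans a≤s (n≤1+n s)) (trans (sym (+-suc s (suc fuel))) e) run′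
    where
    run′ : UnburntRun B a (suc s)
    run′ r a≤r r≤1+s = [ (λ r<1+s → run r a≤r (≤-pred r<1+s)) , (λ r≡1+s → subst (λ z → B z ≡ false) (sym r≡1+s) b1+s) ]′
                         (m≤n⇒m<n∨m≡n r≤1+s)

  Burnable : Burnt → Set
  Burnable B = ∃ λ v → v < n × B v ≡ false × degAt n v ≤ gathered B v

  single-burnable : ∀ B a → a < n → B a ≡ false → ClosedLeft B a → ClosedRight B a → Burnable B
  single-burnable B a a<n ba closedˡ closedʳ = a , a<n , ba , enough
    where
    enough : degAt n a ≤ gathered B a
    enough rewrite closedˡ | closedʳ = +-monoˡ-≤ (bit (0 <ᵇ a) + bit (suc a <ᵇ n)) (m≤n+m 1 (at c a))

  left-end-burnable : ∀ B a b → a < b → b < n → UnburntRun B a b → ClosedLeft B a → at c a ≢ 0 → Burnable B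
  left-end-burnable B a b a<b b<n run closedˡ ca≢0 = a , <-trans a<b b<n , run a ≤-refl (<⇒≤ a<b) , enough
    where
    enough : degAt n a ≤ gathered B a
    enough rewrite closedˡ | <⇒<ᵇ≡true (<-≤-trans (s≤s a<b) b<n) | run (suc a) (n≤1+n a) a<b
      | +-identityʳ (bit (0 <ᵇ a)) | +-comm (bit (0 <ᵇ a)) 1 =
      +-monoˡ-≤ (bit (0 <ᵇ a)) (+-monoˡ-≤ 1 (n≢0⇒n>0 ca≢0))

  right-end-burnable : ∀ B a b → a < b → b < n → UnburntRun B a b → ClosedRight B b → at c b ≢ 0 → Burnable B
  right-end-burnable B a (suc b) a<1+b 1+b<n run closedʳ cb≢0 = suc b , 1+b<n , run (suc b) (<⇒≤ a<1+b) ≤-refl , enough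
    where
    enough : degAt n (suc b) ≤ gathered B (suc b)
    enough rewrite closedʳ | run b (≤-pred a<1+b) (n≤1+n b) =
      +-monoˡ-≤ (bit (suc (suc b) <ᵇ n)) (+-monoˡ-≤ 1 (n≢0⇒n>0 cb≢0))

  heavy-burnable : ∀ B a v b → a < v → v < b → b < n → UnburntRun B a b → 2 ≤ at c v → Burnable B
  heavy-burnable B a (suc v) b a<1+v 1+v<b b<n run 2≤cv =
    suc v , <-trans 1+v<b b<n , run (suc v) (<⇒≤ a<1+v) (<⇒≤ 1+v<b) , enough
    where
    enough : degAt n (suc v) ≤ gathered B (suc v)
    enough rewrite <⇒<ᵇ≡true (<-≤-trans (s≤s 1+v<b) b<n) | run v (≤-pred a<1+v) (≤-trans (n≤1+n v) (<⇒≤ 1+v<b))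
      | run (suc (suc v)) (≤-trans (<⇒≤ a<1+v) (n≤1+n _)) 1+v<b = +-monoˡ-≤ 0 (+-monoˡ-≤ 1 2≤cv)

  heavy-between : ∀ a b → a < b → b < n → at c a ≡ 0 → at c b ≡ 0 → ∃ λ v → a < v × v < b × 2 ≤ at c v
  heavy-between a b a<b b<n ca cb with bounded-search (λ v → a < v → at c v ≤ 1) (λ v → (a <? v) →-dec (at c v ≤? 1)) b
  ... | inj₁ light = ⊥-elim (nf a b (a<b , b<n , ca , cb , λ v a<v v<b → light v v<b a<v))
  ... | inj₂ (v , v<b , ¬light) = v , a<v , v<b , ≰⇒> (λ cv≤1 → ¬light (λ _ → cv≤1))
    where
    a<v : a < v
    a<v with a <? v
    ... | yes a<v = a<v
    ... | no a≮v = ⊥-elim (¬light (λ a<v → ⊥-elim (a≮v a<v)))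

  run-burnable : ∀ B a b → a ≤ b → b < n → UnburntRun B a b → ClosedLeft B a → ClosedRight B b → Burnable B
  run-burnable B a b a≤b b<n run closedˡ closedʳ with m≤n⇒m<n∨m≡n a≤b
  ... | inj₂ refl = single-burnable B a b<n (run a ≤-refl ≤-refl) closedˡ closedʳ
  ... | inj₁ a<b with at c a ≟ 0 | at c b ≟ 0
  ...   | no ca≢0 | _ = left-end-burnable B a b a<b b<n run closedˡ ca≢0
  ...   | yes _ | no cb≢0 = right-end-burnable B a b a<b b<n run closedʳ cb≢0
  ...   | yes ca | yes cb =
    let (v , a<v , v<b , 2≤cv) = heavy-between a b a<b b<n ca cb
    in heavy-burnable B a v b a<v v<b b<n run 2≤cv

  some-burnable : ∀ B u → unburnt B n ≡ suc u → Burnable B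
  some-burnable B u e =
    let (t , t<n , bt) = unburnt≢0⇒unburnt B n u e
        (a , a≤t , runᵗ , closedˡ) = leftmost-in-run B t bt
        a<n = ≤-<-trans a≤t t<n
        (b , a≤b , b<n , run , closedʳ) =
          rightmost-in-run B a (n ∸ suc a) a ≤-refl (trans (+-suc a _) (m+[n∸m]≡n a<n))
            (λ r a≤r r≤a → runᵗ r a≤r (≤-trans r≤a a≤t))
    in run-burnable B a b a≤b b<n run closedˡ closedʳ

  burnt-everywhere : ∀ B → (∀ s → s < n → B s ≡ true) → burningConfig B ≡ c
  burnt-everywhere B all = lookup-ext λ k →
    trans (Vecₚ.lookup∘tabulate _ k) (trans (pointwise (toℕ k) (Finₚ.toℕ<n k)) (sym (lookup≡at c k)))
    where
    left : ∀ t → t < n → burntLeft B t ≡ bit (0 <ᵇ t)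
    left zero _ = refl
    left (suc t) 1+t<n rewrite all t (<-trans (n<1+n t) 1+t<n) = refl
    right : ∀ t → burntRight B t ≡ bit (suc t <ᵇ n)
    right t with suc t <ᵇ n in e
    ... | false = refl
    ... | true rewrite all (suc t) (<ᵇ≡true⇒< e) = refl
    pointwise : ∀ t → t < n → afterBurning B t ≡ at c t
    pointwise t t<n rewrite all t t<n | left t t<n | right t =
      trans (cong (_∸ suc X) (trans (+-assoc (at c t) 1 X) (+-comm (at c t) (suc X)))) (m+n∸m≡n (suc X) (at c t))
      where
      X : ℕ
      X = bit (0 <ᵇ t) + bit (suc t <ᵇ n)

  nothing-burnt : burningConfig (λ _ → false) ≡ addGrains (grainList (λ _ → 1)) c
  nothing-burnt = lookup-ext λ k →
    trans (Vecₚ.lookup∘tabulate _ k)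
          (trans (pointwise (toℕ k)) (trans (cong (_+ 1) (sym (lookup≡at c k))) (sym (lookup-addGrains-grainList (λ _ → 1) c k))))
    where
    if-const : ∀ (b : Bool) → (if b then 0 else 0) ≡ 0
    if-const true = refl
    if-const false = refl
    pointwise : ∀ t → afterBurning (λ _ → false) t ≡ at c t + 1
    pointwise t rewrite if-const (0 <ᵇ t) | if-const (suc t <ᵇ n) = +-identityʳ _

  burning-from : ∀ u B → unburnt B n ≡ u → LegalBurn B → burningConfig B ⟶* c
  burning-from zero B e legal = subst (burningConfig B ⟶*_) (burnt-everywhere B (unburnt≡0⇒burnt B n e)) done
  burning-from (suc u) B e legal with some-burnable B u e
  ... | (v , v<n , bv , enough) =
    step (fromℕ< v<n) canTopple
      (subst (_⟶* c) (sym (topple-burningConfig B v v<n bv legal))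
        (burning-from u (burn B v) (suc-injective (trans (unburnt-burn B v n bv v<n) e)) (legal-burn B v bv legal enough)))
    where
    enough′ : degAt n v ≤ afterBurning B v
    enough′ rewrite bv = enough
    canTopple : CanTopple (fromℕ< v<n) (burningConfig B)
    canTopple = subst₂ _≤_ (cong (degAt n) (sym (Finₚ.toℕ-fromℕ< v<n)))
                           (sym (trans (Vecₚ.lookup∘tabulate _ (fromℕ< v<n)) (cong (afterBurning B) (Finₚ.toℕ-fromℕ< v<n))))
                           enough′

  burning : addGrains (grainList (λ _ → 1)) c ⟶* c
  burning = subst (_⟶* c) nothing-burnt (burning-from _ (λ _ → false) refl (λ _ _ ()))

-- maxStable + f = c + 2·(1,…,1) since maxStable ≤ 2 everywhere, and c + 2·(1,…,1) stabilises to c by burning twice.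
chain-from-maxStable : ∀ {n} {c : Config n} → Stable c → NoForbidden c → Star Step maxStable c
chain-from-maxStable {n} {c} sc nf = addGrains-⟶*⇒chain (grainList f) maxStable-stable sc (subst (_⟶* c) twice-burnt burn-twice)
  where
  open Burning c nf using (burning)
  ones : List (Fin n)
  ones = grainList {n} (λ _ → 1)
  f : Fin n → ℕ
  f k = (2 + lookup c k) ∸ pred (deg k)
  burn-twice : addGrains ones (addGrains ones c) ⟶* c
  burn-twice = ⟶*-trans (addGrains-⟶* ones burning) burning
  maxStable≤2 : ∀ k → pred (deg k) ≤ 2
  maxStable≤2 k = +-mono-≤ (bit≤1 (0 <ᵇ toℕ k)) (bit≤1 (suc (toℕ k) <ᵇ n))
  twice-burnt : addGrains ones (addGrains ones c) ≡ addGrains (grainList f) maxStable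
  twice-burnt = lookup-ext λ k → begin
    lookup (addGrains ones (addGrains ones c)) k ≡⟨ lookup-addGrains-grainList _ _ k ⟩
    lookup (addGrains ones c) k + 1              ≡⟨ cong (_+ 1) (lookup-addGrains-grainList _ _ k) ⟩
    lookup c k + 1 + 1                           ≡⟨ trans (+-assoc (lookup c k) 1 1) (+-comm (lookup c k) 2) ⟩
    2 + lookup c k                               ≡⟨ m+[n∸m]≡n (≤-trans (maxStable≤2 k) (m≤m+n 2 _)) ⟨
    pred (deg k) + f k                           ≡⟨ cong (_+ f k) (lookup-maxStable k) ⟨
    lookup maxStable k + f k                     ≡⟨ lookup-addGrains-grainList f maxStable k ⟨
    lookup (addGrains (grainList f) maxStable) k ∎
    where open ≡-Reasoning

recurrent⇔stable×noForbidden : ∀ {n} {c : Config n} → Recurrent c ⇔ (Stable c × NoForbidden c)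
recurrent⇔stable×noForbidden = mk⇔
  (λ (sc , returns) → sc , noForbidden-chain noForbidden-maxStable (returns maxStable (chain-to-maxStable sc)))
  (λ (sc , nf) → sc , λ d c→d → chain-to-maxStable (chain-stable sc c→d) ◅◅ chain-from-maxStable sc nf)

-- The automaton reads a configuration from left to right; its state afterZero records whether the
-- last entry different from 1 was a 0, in which case a further 0 would close a forbidden interval.
Accepted : ∀ {m} → Bool → Vec ℕ m → Set
Accepted afterZero [] = ⊤
Accepted afterZero (zero ∷ t) = (afterZero ≡ false) × Accepted true t
Accepted afterZero (suc zero ∷ t) = Accepted afterZero t
Accepted afterZero (suc (suc zero) ∷ t) = Accepted false t
Accepted afterZero (suc (suc (suc _)) ∷ t) = ⊥

-- Stability on F_{m+1} read from the second vertex on: degree 3 inside, 2 at the end.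
TailBounded : ∀ {m} → Vec ℕ m → Set
TailBounded [] = ⊤
TailBounded (x ∷ []) = x < 2
TailBounded (x ∷ y ∷ t) = x < 3 × TailBounded (y ∷ t)

FanBounded : ∀ {m} → Vec ℕ m → Set
FanBounded [] = ⊤
FanBounded (x ∷ []) = x < 1
FanBounded (x ∷ y ∷ t) = x < 2 × TailBounded (y ∷ t)

BoundedFrom : ∀ {m} → ℕ → ℕ → Vec ℕ m → Set
BoundedFrom N o [] = ⊤
BoundedFrom N o (x ∷ t) = x < degAt N o × BoundedFrom N (suc o) t

boundedFrom⇒< : ∀ {m} N o (v : Vec ℕ m) → BoundedFrom N o v → ∀ s → s < m → at v s < degAt N (o + s)
boundedFrom⇒< N o (x ∷ t) (x< , _) zero _ = subst (λ z → x < degAt N z) (sym (+-identityʳ o)) x<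
boundedFrom⇒< N o (x ∷ t) (_ , t<) (suc s) 1+s<m =
  subst (λ z → at t s < degAt N z) (sym (+-suc o s)) (boundedFrom⇒< N (suc o) t t< s (≤-pred 1+s<m))

<⇒boundedFrom : ∀ {m} N o (v : Vec ℕ m) → (∀ s → s < m → at v s < degAt N (o + s)) → BoundedFrom N o v
<⇒boundedFrom N o [] _ = tt
<⇒boundedFrom N o (x ∷ t) h =
  subst (λ z → x < degAt N z) (+-identityʳ o) (h 0 z<s) ,
  <⇒boundedFrom N (suc o) t (λ s s<m → subst (λ z → at t s < degAt N z) (+-suc o s) (h (suc s) (s≤s s<m)))

stable⇔boundedFrom0 : ∀ {n} (c : Config n) → Stable c ⇔ BoundedFrom n 0 c
stable⇔boundedFrom0 {n} c = mk⇔
  (λ st → <⇒boundedFrom n 0 c λ s s<n →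
    subst (_< degAt n s) (sym (at≡lookup-fromℕ< c s<n))
      (subst (λ z → lookup c (fromℕ< s<n) < degAt n z) (Finₚ.toℕ-fromℕ< s<n) (st (fromℕ< s<n))))
  (λ b i → subst (_< deg i) (sym (lookup≡at c i)) (boundedFrom⇒< n 0 c b (toℕ i) (Finₚ.toℕ<n i)))

2+o<1+o+2+m : ∀ o m → suc (suc o) < suc o + suc (suc m)
2+o<1+o+2+m o m rewrite +-suc o (suc m) | +-suc o m = s≤s (s≤s (s≤s (m≤m+n o m)))

tailBounded⇔boundedFrom : ∀ N o {m} (v : Vec ℕ (suc m)) → suc o + suc m ≡ N → TailBounded v ⇔ BoundedFrom N (suc o) v
tailBounded⇔boundedFrom N o (x ∷ []) e
  rewrite ≮⇒<ᵇ≡false {suc (suc o)} {N} (λ 2+o<N → <-irrefl (trans (cong suc (sym (+-comm o 1))) e) 2+o<N) =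
  mk⇔ (_, tt) proj₁
tailBounded⇔boundedFrom N o (x ∷ y ∷ t) e rewrite <⇒<ᵇ≡true {suc (suc o)} {N} (subst (suc (suc o) <_) e (2+o<1+o+2+m o _)) =
  mk⇔ (λ (x< , t<) → x< , Equivalence.to rest t<) (λ (x< , t<) → x< , Equivalence.from rest t<)
  where
  rest : TailBounded (y ∷ t) ⇔ BoundedFrom N (suc (suc o)) (y ∷ t)
  rest = tailBounded⇔boundedFrom N (suc o) (y ∷ t) (trans (sym (+-suc (suc o) _)) e)

fanBounded⇔boundedFrom0 : ∀ {L} (v : Vec ℕ (suc L)) → FanBounded v ⇔ BoundedFrom (suc L) 0 v
fanBounded⇔boundedFrom0 (x ∷ []) = mk⇔ (_, tt) proj₁
fanBounded⇔boundedFrom0 {suc m} (x ∷ y ∷ t) =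
  mk⇔ (λ (x< , t<) → x< , Equivalence.to rest t<) (λ (x< , t<) → x< , Equivalence.from rest t<)
  where
  rest : TailBounded (y ∷ t) ⇔ BoundedFrom (suc (suc m)) 1 (y ∷ t)
  rest = tailBounded⇔boundedFrom (suc (suc m)) 0 (y ∷ t) refl

ZeroAfterOnes : ∀ {m} → Vec ℕ m → Set
ZeroAfterOnes {m} t = ∃ λ b → b < m × at t b ≡ 0 × (∀ v → v < b → at t v ≤ 1)

noForbidden-tail : ∀ {m} x (t : Vec ℕ m) → NoForbidden (x ∷ t) → NoForbidden t
noForbidden-tail x t nf a b (a<b , b<m , ta , tb , mid) = nf (suc a) (suc b) (s≤s a<b , s≤s b<m , ta , tb , mid′)
  where
  mid′ : ∀ v → suc a < v → v < suc b → at (x ∷ t) v ≤ 1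
  mid′ (suc v) 1+a<1+v 1+v<1+b = mid v (≤-pred 1+a<1+v) (≤-pred 1+v<1+b)

noForbidden-head : ∀ {m} (t : Vec ℕ m) → NoForbidden (0 ∷ t) → ¬ ZeroAfterOnes t
noForbidden-head t nf (b , b<m , tb , ones) = nf 0 (suc b) (z<s , s≤s b<m , refl , tb , mid)
  where
  mid : ∀ v → 0 < v → v < suc b → at (0 ∷ t) v ≤ 1
  mid (suc v) _ 1+v<1+b = ones v (≤-pred 1+v<1+b)

noForbidden-∷ : ∀ {m} x (t : Vec ℕ m) → NoForbidden t → (x ≡ 0 → ¬ ZeroAfterOnes t) → NoForbidden (x ∷ t)
noForbidden-∷ x t nf _ zero zero (() , _)
noForbidden-∷ x t nf opens zero (suc b) (_ , 1+b<1+m , x≡0 , tb , mid) =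
  opens x≡0 (b , ≤-pred 1+b<1+m , tb , λ v v<b → mid (suc v) z<s (s≤s v<b))
noForbidden-∷ x t nf _ (suc a) zero (() , _)
noForbidden-∷ x t nf _ (suc a) (suc b) (a<b , b<m , ta , tb , mid) =
  nf a b (≤-pred a<b , ≤-pred b<m , ta , tb , λ v a<v v<b → mid (suc v) (s≤s a<v) (s≤s v<b))

zeroAfterOnes-∷ : ∀ {m} x (t : Vec ℕ m) → ZeroAfterOnes (x ∷ t) → x ≡ 0 ⊎ (x ≤ 1 × ZeroAfterOnes t)
zeroAfterOnes-∷ x t (zero , _ , x≡0 , _) = inj₁ x≡0
zeroAfterOnes-∷ x t (suc b , 1+b<1+m , tb , ones) = inj₂ (ones 0 z<s , b , ≤-pred 1+b<1+m , tb , λ v v<b → ones (suc v) (s≤s v<b))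

zeroAfterOnes-0∷ : ∀ {m} (t : Vec ℕ m) → ZeroAfterOnes (0 ∷ t)
zeroAfterOnes-0∷ t = 0 , z<s , refl , λ v ()

zeroAfterOnes-1∷ : ∀ {m} (t : Vec ℕ m) → ZeroAfterOnes t → ZeroAfterOnes (1 ∷ t)
zeroAfterOnes-1∷ t (b , b<m , tb , ones) = suc b , s≤s b<m , tb , ones′
  where
  ones′ : ∀ v → v < suc b → at (1 ∷ t) v ≤ 1
  ones′ zero _ = ≤-refl
  ones′ (suc v) 1+v<1+b = ones v (≤-pred 1+v<1+b)

accepted⇒noForbidden : ∀ {m} afterZero (w : Vec ℕ m) → Accepted afterZero w →
  NoForbidden w × (afterZero ≡ true → ¬ ZeroAfterOnes w)
accepted⇒noForbidden _ [] _ = (λ { a b (_ , () , _) }) , λ { _ (b , () , _) }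
accepted⇒noForbidden _ (zero ∷ t) (refl , acc) =
  let (nf , closes) = accepted⇒noForbidden true t acc in noForbidden-∷ 0 t nf (λ _ → closes refl) , λ ()
accepted⇒noForbidden afterZero (suc zero ∷ t) acc =
  let (nf , closes) = accepted⇒noForbidden afterZero t acc
  in noForbidden-∷ 1 t nf (λ ()) , λ armed z → [ (λ ()) , (λ (_ , zt) → closes armed zt) ]′ (zeroAfterOnes-∷ 1 t z)
accepted⇒noForbidden _ (suc (suc zero) ∷ t) acc =
  let (nf , _) = accepted⇒noForbidden false t acc
  in noForbidden-∷ 2 t nf (λ ()) , λ _ z → [ (λ ()) , (λ { (s≤s () , _) }) ]′ (zeroAfterOnes-∷ 2 t z)

AllAtMost2 : ∀ {m} → Vec ℕ m → Set
AllAtMost2 [] = ⊤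
AllAtMost2 (x ∷ t) = x ≤ 2 × AllAtMost2 t

noForbidden⇒accepted : ∀ {m} afterZero (w : Vec ℕ m) → AllAtMost2 w → NoForbidden w →
  (afterZero ≡ true → ¬ ZeroAfterOnes w) → Accepted afterZero w
noForbidden⇒accepted _ [] _ _ _ = tt
noForbidden⇒accepted false (zero ∷ t) (_ , ≤2) nf _ =
  refl , noForbidden⇒accepted true t ≤2 (noForbidden-tail 0 t nf) (λ _ → noForbidden-head t nf)
noForbidden⇒accepted true (zero ∷ t) _ _ closes = ⊥-elim (closes refl (zeroAfterOnes-0∷ t))
noForbidden⇒accepted afterZero (suc zero ∷ t) (_ , ≤2) nf closes =
  noForbidden⇒accepted afterZero t ≤2 (noForbidden-tail 1 t nf) (λ armed zt → closes armed (zeroAfterOnes-1∷ t zt))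
noForbidden⇒accepted _ (suc (suc zero) ∷ t) (_ , ≤2) nf _ = noForbidden⇒accepted false t ≤2 (noForbidden-tail 2 t nf) (λ ())
noForbidden⇒accepted _ (suc (suc (suc x)) ∷ t) (s≤s (s≤s ()) , _) _ _

tailBounded⇒allAtMost2 : ∀ {m} (v : Vec ℕ m) → TailBounded v → AllAtMost2 v
tailBounded⇒allAtMost2 [] _ = tt
tailBounded⇒allAtMost2 (x ∷ []) x<2 = ≤-trans (≤-pred x<2) (n≤1+n 1) , tt
tailBounded⇒allAtMost2 (x ∷ y ∷ t) (x<3 , t<) = ≤-pred x<3 , tailBounded⇒allAtMost2 (y ∷ t) t<

fanBounded⇒allAtMost2 : ∀ {m} (v : Vec ℕ m) → FanBounded v → AllAtMost2 v
fanBounded⇒allAtMost2 [] _ = tt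
fanBounded⇒allAtMost2 (x ∷ []) x<1 = ≤-trans (≤-pred x<1) z≤n , tt
fanBounded⇒allAtMost2 (x ∷ y ∷ t) (x<2 , t<) = ≤-trans (≤-pred x<2) (n≤1+n 1) , tailBounded⇒allAtMost2 (y ∷ t) t<

stable×noForbidden⇔fanBounded×accepted : ∀ {L} (c : Config (suc L)) → (Stable c × NoForbidden c) ⇔ (FanBounded c × Accepted false c)
stable×noForbidden⇔fanBounded×accepted {L} c = mk⇔
  (λ (st , nf) → let fb = bounded (Equivalence.to (stable⇔boundedFrom0 c) st)
                 in fb , noForbidden⇒accepted false c (fanBounded⇒allAtMost2 c fb) nf (λ ()))
  (λ (fb , acc) → Equivalence.from (stable⇔boundedFrom0 c) (Equivalence.to (fanBounded⇔boundedFrom0 c) fb) ,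
                  proj₁ (accepted⇒noForbidden false c acc))
  where
  bounded : BoundedFrom (suc L) 0 c → FanBounded c
  bounded = Equivalence.from (fanBounded⇔boundedFrom0 c)

-- Enumeration

-- Words of length L+1 of level k, that is with sum + 1 ≡ k + (L+1).
tailWords : Bool → (L : ℕ) → ℕ → List (Vec ℕ (suc L))
twoThen : (L : ℕ) → ℕ → List (Vec ℕ (suc (suc L)))
tailWords _ zero (suc zero) = (1 ∷ []) ∷ []
tailWords _ zero (suc (suc k)) = []
tailWords false zero zero = (0 ∷ []) ∷ []
tailWords true zero zero = []
tailWords false (suc L) k = List.map (0 ∷_) (tailWords true L (suc k)) ++ (List.map (1 ∷_) (tailWords false L k) ++ twoThen L k)
tailWords true (suc L) k = List.map (1 ∷_) (tailWords true L k) ++ twoThen L k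
twoThen L zero = []
twoThen L (suc k) = List.map (2 ∷_) (tailWords false L k)

fanWords : (L : ℕ) → ℕ → List (Vec ℕ (suc L))
fanWords zero zero = (0 ∷ []) ∷ []
fanWords zero (suc k) = []
fanWords (suc L) k = List.map (1 ∷_) (tailWords false L k) ++ List.map (0 ∷_) (tailWords true L (suc k))

IsTailWord : Bool → (L : ℕ) → ℕ → Vec ℕ (suc L) → Set
IsTailWord afterZero L k v = TailBounded v × Accepted afterZero v × (Vec.sum v + 1 ≡ k + suc L)

IsFanWord : (L : ℕ) → ℕ → Vec ℕ (suc L) → Set
IsFanWord L k v = FanBounded v × Accepted false v × (Vec.sum v + 1 ≡ k + suc L)

accepted⇒length≤sum : ∀ {m} (t : Vec ℕ m) → Accepted true t → m ≤ Vec.sum t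
accepted⇒length≤1+sum : ∀ {m} (t : Vec ℕ m) → Accepted false t → m ≤ suc (Vec.sum t)
accepted⇒length≤sum [] _ = z≤n
accepted⇒length≤sum (zero ∷ t) (() , _)
accepted⇒length≤sum (suc zero ∷ t) acc = s≤s (accepted⇒length≤sum t acc)
accepted⇒length≤sum (suc (suc zero) ∷ t) acc = s≤s (accepted⇒length≤1+sum t acc)
accepted⇒length≤1+sum [] _ = z≤n
accepted⇒length≤1+sum (zero ∷ t) (_ , acc) = s≤s (accepted⇒length≤sum t acc)
accepted⇒length≤1+sum (suc zero ∷ t) acc = s≤s (accepted⇒length≤1+sum t acc)
accepted⇒length≤1+sum (suc (suc zero) ∷ t) acc = s≤s (≤-trans (accepted⇒length≤1+sum t acc) (n≤1+n _))

isTailWord-0∷ : ∀ L k (t : Vec ℕ (suc L)) → IsTailWord true L (suc k) t → IsTailWord false (suc L) k (0 ∷ t)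
isTailWord-0∷ L k (y ∷ t) (b , acc , e) = (z<s , b) , (refl , acc) , trans e (sym (+-suc k (suc L)))

isTailWord-1∷ : ∀ afterZero L k (t : Vec ℕ (suc L)) → IsTailWord afterZero L k t → IsTailWord afterZero (suc L) k (1 ∷ t)
isTailWord-1∷ _ L k (y ∷ t) (b , acc , e) = (s≤s z<s , b) , acc , trans (cong suc e) (sym (+-suc k (suc L)))

isTailWord-2∷ : ∀ afterZero L k (t : Vec ℕ (suc L)) → IsTailWord false L k t → IsTailWord afterZero (suc L) (suc k) (2 ∷ t)
isTailWord-2∷ _ L k (y ∷ t) (b , acc , e) = (s≤s (s≤s z<s) , b) , acc , cong suc (trans (cong suc e) (sym (+-suc k (suc L))))

k+1≢0 : ∀ k → k + 1 ≢ 0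
k+1≢0 k e = 1+n≢0 (trans (+-comm 1 k) e)

∈tailWords⇒isTailWord : ∀ afterZero L k v → v ∈ tailWords afterZero L k → IsTailWord afterZero L k v
∈tailWords⇒isTailWord false zero zero v (here refl) = z<s , (refl , tt) , refl
∈tailWords⇒isTailWord _ zero (suc zero) v (here refl) = s≤s z<s , tt , refl
∈tailWords⇒isTailWord false (suc L) k v v∈ with ∈-++⁻ (List.map (0 ∷_) (tailWords true L (suc k))) v∈
... | inj₁ v∈₀ with ∈-map⁻ (0 ∷_) v∈₀
...   | (t , t∈ , refl) = isTailWord-0∷ L k t (∈tailWords⇒isTailWord true L (suc k) t t∈)
∈tailWords⇒isTailWord false (suc L) k v v∈ | inj₂ v∈′ with ∈-++⁻ (List.map (1 ∷_) (tailWords false L k)) v∈′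
... | inj₁ v∈₁ with ∈-map⁻ (1 ∷_) v∈₁
...   | (t , t∈ , refl) = isTailWord-1∷ false L k t (∈tailWords⇒isTailWord false L k t t∈)
∈tailWords⇒isTailWord false (suc L) (suc k) v v∈ | inj₂ _ | inj₂ v∈₂ with ∈-map⁻ (2 ∷_) v∈₂
...   | (t , t∈ , refl) = isTailWord-2∷ false L k t (∈tailWords⇒isTailWord false L k t t∈)
∈tailWords⇒isTailWord true (suc L) k v v∈ with ∈-++⁻ (List.map (1 ∷_) (tailWords true L k)) v∈
... | inj₁ v∈₁ with ∈-map⁻ (1 ∷_) v∈₁
...   | (t , t∈ , refl) = isTailWord-1∷ true L k t (∈tailWords⇒isTailWord true L k t t∈)
∈tailWords⇒isTailWord true (suc L) (suc k) v v∈ | inj₂ v∈₂ with ∈-map⁻ (2 ∷_) v∈₂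
...   | (t , t∈ , refl) = isTailWord-2∷ true L k t (∈tailWords⇒isTailWord false L k t t∈)

isTailWord⇒∈tailWords : ∀ afterZero L k v → IsTailWord afterZero L k v → v ∈ tailWords afterZero L k
isTailWord⇒∈tailWords _ zero zero (zero ∷ []) (_ , (refl , _) , _) = here refl
isTailWord⇒∈tailWords _ zero (suc k) (zero ∷ []) (_ , _ , e) = ⊥-elim (k+1≢0 k (sym (suc-injective e)))
isTailWord⇒∈tailWords _ zero (suc zero) (suc zero ∷ []) _ = here refl
isTailWord⇒∈tailWords _ zero (suc (suc k)) (suc zero ∷ []) (_ , _ , e) = ⊥-elim (k+1≢0 k (sym (suc-injective (suc-injective e))))
isTailWord⇒∈tailWords _ zero k (suc (suc x) ∷ []) (s≤s (s≤s ()) , _)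
isTailWord⇒∈tailWords _ (suc L) k (zero ∷ y ∷ t) ((_ , b) , (refl , acc) , e) =
  ∈-++⁺ˡ (∈-map⁺ (0 ∷_) (isTailWord⇒∈tailWords true L (suc k) (y ∷ t) (b , acc , trans e (+-suc k (suc L)))))
isTailWord⇒∈tailWords false (suc L) k (suc zero ∷ y ∷ t) ((_ , b) , acc , e) =
  ∈-++⁺ʳ (List.map (0 ∷_) (tailWords true L (suc k)))
    (∈-++⁺ˡ (∈-map⁺ (1 ∷_) (isTailWord⇒∈tailWords false L k (y ∷ t) (b , acc , suc-injective (trans e (+-suc k (suc L)))))))
isTailWord⇒∈tailWords true (suc L) k (suc zero ∷ y ∷ t) ((_ , b) , acc , e) =
  ∈-++⁺ˡ (∈-map⁺ (1 ∷_) (isTailWord⇒∈tailWords true L k (y ∷ t) (b , acc , suc-injective (trans e (+-suc k (suc L))))))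
isTailWord⇒∈tailWords _ (suc L) zero (suc (suc zero) ∷ t) (_ , acc , e) =
  ⊥-elim (<-irrefl (sym e) (≤-trans (s≤s (s≤s (accepted⇒length≤1+sum t acc))) (≤-reflexive (cong (suc ∘ suc) (+-comm 1 (Vec.sum t))))))
isTailWord⇒∈tailWords false (suc L) (suc k) (suc (suc zero) ∷ y ∷ t) ((_ , b) , acc , e) =
  ∈-++⁺ʳ (List.map (0 ∷_) (tailWords true L (suc (suc k))))
    (∈-++⁺ʳ (List.map (1 ∷_) (tailWords false L (suc k)))
      (∈-map⁺ (2 ∷_) (isTailWord⇒∈tailWords false L k (y ∷ t) (b , acc , level-of-tail e))))
  where
  level-of-tail : ∀ {s} → suc (suc (s + 1)) ≡ suc k + suc (suc L) → s + 1 ≡ k + suc L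
  level-of-tail e = suc-injective (suc-injective (trans e (cong suc (+-suc k (suc L)))))
isTailWord⇒∈tailWords true (suc L) (suc k) (suc (suc zero) ∷ y ∷ t) ((_ , b) , acc , e) =
  ∈-++⁺ʳ (List.map (1 ∷_) (tailWords true L (suc k)))
    (∈-map⁺ (2 ∷_) (isTailWord⇒∈tailWords false L k (y ∷ t) (b , acc , level-of-tail e)))
  where
  level-of-tail : ∀ {s} → suc (suc (s + 1)) ≡ suc k + suc (suc L) → s + 1 ≡ k + suc L
  level-of-tail e = suc-injective (suc-injective (trans e (cong suc (+-suc k (suc L)))))

∈fanWords⇔isFanWord : ∀ L k v → (v ∈ fanWords L k) ⇔ IsFanWord L k v
∈fanWords⇔isFanWord L k v = mk⇔ (to L k v) (from L k v)
  where
  to : ∀ L k v → v ∈ fanWords L k → IsFanWord L k v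
  to zero zero v (here refl) = z<s , (refl , tt) , refl
  to (suc L) k v v∈ with ∈-++⁻ (List.map (1 ∷_) (tailWords false L k)) v∈
  ... | inj₁ v∈₁ with ∈-map⁻ (1 ∷_) v∈₁
  ...   | (y ∷ t , t∈ , refl) =
    let (b , acc , e) = ∈tailWords⇒isTailWord false L k (y ∷ t) t∈
    in (s≤s z<s , b) , acc , trans (cong suc e) (sym (+-suc k (suc L)))
  to (suc L) k v v∈ | inj₂ v∈₀ with ∈-map⁻ (0 ∷_) v∈₀
  ...   | (y ∷ t , t∈ , refl) =
    let (b , acc , e) = ∈tailWords⇒isTailWord true L (suc k) (y ∷ t) t∈
    in (z<s , b) , (refl , acc) , trans e (sym (+-suc k (suc L)))
  from : ∀ L k v → IsFanWord L k v → v ∈ fanWords L k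
  from zero zero (zero ∷ []) _ = here refl
  from zero (suc k) (zero ∷ []) (_ , _ , e) = ⊥-elim (k+1≢0 k (sym (suc-injective e)))
  from zero k (suc x ∷ []) (s≤s () , _)
  from (suc L) k (zero ∷ y ∷ t) ((_ , b) , (_ , acc) , e) =
    ∈-++⁺ʳ (List.map (1 ∷_) (tailWords false L k))
      (∈-map⁺ (0 ∷_) (isTailWord⇒∈tailWords true L (suc k) (y ∷ t) (b , acc , trans e (+-suc k (suc L)))))
  from (suc L) k (suc zero ∷ y ∷ t) ((_ , b) , acc , e) =
    ∈-++⁺ˡ (∈-map⁺ (1 ∷_) (isTailWord⇒∈tailWords false L k (y ∷ t) (b , acc , suc-injective (trans e (+-suc k (suc L))))))
  from (suc L) k (suc (suc x) ∷ y ∷ t) ((s≤s (s≤s ()) , _) , _)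

head-∈-map-∷ : ∀ {L} {x : ℕ} {ws : List (Vec ℕ L)} {v} → v ∈ List.map (x ∷_) ws → head v ≡ x
head-∈-map-∷ {x = x} v∈ with ∈-map⁻ (x ∷_) v∈
... | (_ , _ , refl) = refl

head-∈-twoThen : ∀ L k {v} → v ∈ twoThen L k → head v ≡ 2
head-∈-twoThen L (suc k) v∈ = head-∈-map-∷ v∈

unique-map-∷ : ∀ {L} (x : ℕ) {ws : List (Vec ℕ L)} → Unique ws → Unique (List.map (x ∷_) ws)
unique-map-∷ x = Uniqueₚ.map⁺ Vecₚ.∷-injectiveʳ

heads-differ : ∀ {L} {x y : ℕ} {ws us : List (Vec ℕ L)} {v} → x ≢ y → v ∈ List.map (x ∷_) ws → ¬ v ∈ List.map (y ∷_) us
heads-differ x≢y v∈ws v∈us = x≢y (trans (sym (head-∈-map-∷ v∈ws)) (head-∈-map-∷ v∈us))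

unique-singleton : ∀ {A : Set} {a : A} → Unique (a ∷ [])
unique-singleton = All.[] AllPairs.∷ AllPairs.[]

tailWords-unique : ∀ afterZero L k → Unique (tailWords afterZero L k)
twoThen-unique : ∀ L k → Unique (twoThen L k)
tailWords-unique _ zero (suc zero) = unique-singleton
tailWords-unique _ zero (suc (suc k)) = AllPairs.[]
tailWords-unique false zero zero = unique-singleton
tailWords-unique true zero zero = AllPairs.[]
tailWords-unique false (suc L) k =
  Uniqueₚ.++⁺ (unique-map-∷ 0 (tailWords-unique true L (suc k)))
    (Uniqueₚ.++⁺ (unique-map-∷ 1 (tailWords-unique false L k)) (twoThen-unique L k)
      (λ (v∈₁ , v∈₂) → 1≢2 (trans (sym (head-∈-map-∷ v∈₁)) (head-∈-twoThen L k v∈₂))))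
    (λ (v∈₀ , v∈′) → [ heads-differ (λ ()) v∈₀ , (λ v∈₂ → 0≢2 (trans (sym (head-∈-map-∷ v∈₀)) (head-∈-twoThen L k v∈₂))) ]′
                       (∈-++⁻ (List.map (1 ∷_) (tailWords false L k)) v∈′))
  where
  0≢2 : 0 ≢ 2
  0≢2 ()
  1≢2 : 1 ≢ 2
  1≢2 ()
tailWords-unique true (suc L) k =
  Uniqueₚ.++⁺ (unique-map-∷ 1 (tailWords-unique true L k)) (twoThen-unique L k)
    (λ (v∈₁ , v∈₂) → 1≢2 (trans (sym (head-∈-map-∷ v∈₁)) (head-∈-twoThen L k v∈₂)))
  where
  1≢2 : 1 ≢ 2
  1≢2 ()
twoThen-unique L zero = AllPairs.[]
twoThen-unique L (suc k) = unique-map-∷ 2 (tailWords-unique false L k)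

fanWords-unique : ∀ L k → Unique (fanWords L k)
fanWords-unique zero zero = unique-singleton
fanWords-unique zero (suc k) = AllPairs.[]
fanWords-unique (suc L) k =
  Uniqueₚ.++⁺ (unique-map-∷ 1 (tailWords-unique false L k)) (unique-map-∷ 0 (tailWords-unique true L (suc k)))
    (λ (v∈₁ , v∈₀) → heads-differ (λ ()) v∈₁ v∈₀)

tailCount : Bool → ℕ → ℕ → ℕ
twoThenCount : ℕ → ℕ → ℕ
tailCount _ zero (suc zero) = 1
tailCount _ zero (suc (suc k)) = 0
tailCount false zero zero = 1
tailCount true zero zero = 0
tailCount false (suc L) k = tailCount true L (suc k) + tailCount false L k + twoThenCount L k
tailCount true (suc L) k = tailCount true L k + twoThenCount L k
twoThenCount L zero = 0
twoThenCount L (suc k) = tailCount false L k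

fanWordCount : ℕ → ℕ → ℕ
fanWordCount zero zero = 1
fanWordCount zero (suc k) = 0
fanWordCount (suc L) k = tailCount false L k + tailCount true L (suc k)

length-tailWords : ∀ afterZero L k → length (tailWords afterZero L k) ≡ tailCount afterZero L k
length-twoThen : ∀ L k → length (twoThen L k) ≡ twoThenCount L k
length-tailWords _ zero (suc zero) = refl
length-tailWords _ zero (suc (suc k)) = refl
length-tailWords false zero zero = refl
length-tailWords true zero zero = refl
length-tailWords false (suc L) k = begin
  length (List.map (0 ∷_) (tailWords true L (suc k)) ++ (List.map (1 ∷_) (tailWords false L k) ++ twoThen L k))
    ≡⟨ length-++ (List.map (0 ∷_) (tailWords true L (suc k))) ⟩
  length (List.map (0 ∷_) (tailWords true L (suc k))) + length (List.map (1 ∷_) (tailWords false L k) ++ twoThen L k)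
    ≡⟨ cong₂ _+_ (length-map (0 ∷_) (tailWords true L (suc k))) (length-++ (List.map (1 ∷_) (tailWords false L k))) ⟩
  length (tailWords true L (suc k)) + (length (List.map (1 ∷_) (tailWords false L k)) + length (twoThen L k))
    ≡⟨ cong (λ z → length (tailWords true L (suc k)) + (z + length (twoThen L k))) (length-map (1 ∷_) (tailWords false L k)) ⟩
  length (tailWords true L (suc k)) + (length (tailWords false L k) + length (twoThen L k))
    ≡⟨ cong₂ _+_ (length-tailWords true L (suc k)) (cong₂ _+_ (length-tailWords false L k) (length-twoThen L k)) ⟩
  tailCount true L (suc k) + (tailCount false L k + twoThenCount L k)
    ≡⟨ +-assoc (tailCount true L (suc k)) _ _ ⟨
  tailCount false (suc L) k ∎
  where open ≡-Reasoning
length-tailWords true (suc L) k =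
  trans (length-++ (List.map (1 ∷_) (tailWords true L k)))
        (cong₂ _+_ (trans (length-map (1 ∷_) (tailWords true L k)) (length-tailWords true L k)) (length-twoThen L k))
length-twoThen L zero = refl
length-twoThen L (suc k) = trans (length-map (2 ∷_) (tailWords false L k)) (length-tailWords false L k)

length-fanWords : ∀ L k → length (fanWords L k) ≡ fanWordCount L k
length-fanWords zero zero = refl
length-fanWords zero (suc k) = refl
length-fanWords (suc L) k =
  trans (length-++ (List.map (1 ∷_) (tailWords false L k)))
        (cong₂ _+_ (trans (length-map (1 ∷_) (tailWords false L k)) (length-tailWords false L k))
                   (trans (length-map (0 ∷_) (tailWords true L (suc k))) (length-tailWords true L (suc k))))

tailCount-true≡fanWordCount : ∀ L k → tailCount true L (suc k) ≡ fanWordCount L k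
tailCount-true≡fanWordCount zero zero = refl
tailCount-true≡fanWordCount zero (suc k) = refl
tailCount-true≡fanWordCount (suc L) k = +-comm (tailCount true L (suc k)) (tailCount false L k)

fanWordCount-suc : ∀ L k → fanWordCount (suc L) k ≡ tailCount false L k + fanWordCount L k
fanWordCount-suc L k = cong (tailCount false L k +_) (tailCount-true≡fanWordCount L k)

tailCount-false-suc : ∀ L k → tailCount false (suc L) k ≡ fanWordCount L k + tailCount false L k + twoThenCount L k
tailCount-false-suc L k = cong (λ z → z + tailCount false L k + twoThenCount L k) (tailCount-true≡fanWordCount L k)

sumUpTo : ℕ → (ℕ → ℕ) → ℕ
sumUpTo N g = listSum (applyUpTo g N)

sumUpTo-cong : ∀ N {g h : ℕ → ℕ} → (∀ r → g r ≡ h r) → sumUpTo N g ≡ sumUpTo N h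
sumUpTo-cong zero _ = refl
sumUpTo-cong (suc N) g≗h = cong₂ _+_ (g≗h 0) (sumUpTo-cong N (g≗h ∘ suc))

sumUpTo-+ : ∀ N (g h : ℕ → ℕ) → sumUpTo N (λ r → g r + h r) ≡ sumUpTo N g + sumUpTo N h
sumUpTo-+ zero g h = refl
sumUpTo-+ (suc N) g h rewrite sumUpTo-+ N (g ∘ suc) (h ∘ suc) = interchange (g 0) (h 0) _ _

sumUpTo-suc : ∀ N (g : ℕ → ℕ) → sumUpTo (suc N) g ≡ sumUpTo N g + g N
sumUpTo-suc zero g = +-identityʳ (g 0)
sumUpTo-suc (suc N) g rewrite sumUpTo-suc N (g ∘ suc) = sym (+-assoc (g 0) _ _)

fanSum fanSum⁺ : ℕ → ℕ → ℕ
fanSum m k = sumUpTo (suc m) (λ r → (m C r) * ((r + k) C r))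
fanSum⁺ m k = sumUpTo (suc m) (λ r → (m C r) * ((suc r + k) C suc r))

fanSum⁺-zero : ∀ m → fanSum⁺ m 0 ≡ fanSum m 0
fanSum⁺-zero m = sumUpTo-cong (suc m) λ r → cong ((m C r) *_) (trans (nC[n+0]≡1 (suc r)) (sym (nC[n+0]≡1 r)))
  where
  nC[n+0]≡1 : ∀ r → (r + 0) C r ≡ 1
  nC[n+0]≡1 r = trans (cong (_C r) (+-identityʳ r)) (nCn≡1 r)

fanSum⁺-suc : ∀ m k → fanSum⁺ m (suc k) ≡ fanSum⁺ m k + fanSum m (suc k)
fanSum⁺-suc m k =
  trans (sumUpTo-cong (suc m) pascal) (sumUpTo-+ (suc m) (λ r → (m C r) * ((suc r + k) C suc r)) (λ r → (m C r) * ((r + suc k) C r)))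
  where
  pascal : ∀ r → (m C r) * ((suc r + suc k) C suc r) ≡ (m C r) * ((suc r + k) C suc r) + (m C r) * ((r + suc k) C r)
  pascal r = trans (cong ((m C r) *_) (begin
      (suc r + suc k) C suc r                              ≡⟨ nCk+nC[k+1]≡[n+1]C[k+1] (r + suc k) r ⟨
      ((r + suc k) C r) + ((r + suc k) C suc r)            ≡⟨ +-comm ((r + suc k) C r) _ ⟩
      ((r + suc k) C suc r) + ((r + suc k) C r)            ≡⟨ cong (λ z → (z C suc r) + ((r + suc k) C r)) (+-suc r k) ⟩
      ((suc r + k) C suc r) + ((r + suc k) C r)            ∎))
    (*-distribˡ-+ (m C r) _ _)
    where open ≡-Reasoning

fanSum-suc : ∀ m k → fanSum (suc m) k ≡ fanSum m k + fanSum⁺ m k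
fanSum-suc m k = begin
    fanSum (suc m) k
  ≡⟨ cong (a₀ +_) (sumUpTo-cong (suc m) pascal) ⟩
    a₀ + sumUpTo (suc m) (λ r → (m C r) * a (suc r) + shifted r)
  ≡⟨ cong (a₀ +_) (sumUpTo-+ (suc m) (λ r → (m C r) * a (suc r)) shifted) ⟩
    a₀ + (fanSum⁺ m k + sumUpTo (suc m) shifted)
  ≡⟨ cong (λ z → a₀ + (fanSum⁺ m k + z)) last-vanishes ⟩
    a₀ + (fanSum⁺ m k + sumUpTo m shifted)
  ≡⟨ cong (a₀ +_) (+-comm (fanSum⁺ m k) _) ⟩
    a₀ + (sumUpTo m shifted + fanSum⁺ m k)
  ≡⟨ +-assoc a₀ (sumUpTo m shifted) (fanSum⁺ m k) ⟨
    fanSum m k + fanSum⁺ m k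
  ∎
  where
  open ≡-Reasoning
  a : ℕ → ℕ
  a r = (r + k) C r
  a₀ : ℕ
  a₀ = (m C 0) * a 0
  shifted : ℕ → ℕ
  shifted r = (m C suc r) * a (suc r)
  pascal : ∀ r → (suc m C suc r) * a (suc r) ≡ (m C r) * a (suc r) + shifted r
  pascal r = trans (cong (_* a (suc r)) (sym (nCk+nC[k+1]≡[n+1]C[k+1] m r))) (*-distribʳ-+ (a (suc r)) (m C r) _)
  last-vanishes : sumUpTo (suc m) shifted ≡ sumUpTo m shifted
  last-vanishes = trans (sumUpTo-suc m shifted)
    (trans (cong (sumUpTo m shifted +_) (cong (_* a (suc m)) (k>n⇒nCk≡0 (n<1+n m)))) (+-identityʳ _))

-- Both counts are needed in the induction on L, including their values beyond the range d + k = L.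
record CountsAt (L : ℕ) : Set where
  field
    fanWordCount≡fanSum : ∀ d k → d + k ≡ L → fanWordCount L k ≡ fanSum d k
    fanWordCount-above : ∀ k → L < k → fanWordCount L k ≡ 0
    tailCount≡fanSum⁺ : ∀ d k → d + k ≡ L → tailCount false L k ≡ fanSum⁺ d k
    tailCount-top : tailCount false L (suc L) ≡ 1
    tailCount-above : ∀ k → suc L < k → tailCount false L k ≡ 0

countsAt-zero : CountsAt 0
countsAt-zero = record
  { fanWordCount≡fanSum = λ { zero zero _ → refl }
  ; fanWordCount-above = λ { (suc k) _ → refl }
  ; tailCount≡fanSum⁺ = λ { zero zero _ → refl }
  ; tailCount-top = refl
  ; tailCount-above = λ { (suc zero) (s≤s ()) ; (suc (suc k)) _ → refl }
  }

countsAt-suc : ∀ L → CountsAt L → CountsAt (suc L)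
countsAt-suc L counts = record
  { fanWordCount≡fanSum = wordCount
  ; fanWordCount-above = wordCount-above
  ; tailCount≡fanSum⁺ = tail
  ; tailCount-top = tail-top
  ; tailCount-above = tail-above
  }
  where
  open CountsAt counts
  wordCount : ∀ d k → d + k ≡ suc L → fanWordCount (suc L) k ≡ fanSum d k
  wordCount zero k refl rewrite fanWordCount-suc L k | tailCount-top | fanWordCount-above (suc L) ≤-refl = refl
  wordCount (suc d) k e rewrite fanWordCount-suc L k | tailCount≡fanSum⁺ d k (suc-injective e)
    | fanWordCount≡fanSum d k (suc-injective e) = trans (+-comm (fanSum⁺ d k) (fanSum d k)) (sym (fanSum-suc d k))
  wordCount-above : ∀ k → suc L < k → fanWordCount (suc L) k ≡ 0
  wordCount-above k lt rewrite fanWordCount-suc L k | tailCount-above k lt | fanWordCount-above k (<-trans (n<1+n L) lt) = refl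
  tail : ∀ d k → d + k ≡ suc L → tailCount false (suc L) k ≡ fanSum⁺ d k
  tail d zero e rewrite tailCount-false-suc L 0 | +-identityʳ d | e | fanWordCount≡fanSum L 0 (+-identityʳ L)
    | tailCount≡fanSum⁺ L 0 (+-identityʳ L) | fanSum⁺-zero (suc L) | fanSum-suc L 0 = +-identityʳ _
  tail zero (suc k) refl rewrite tailCount-false-suc L (suc L) | fanWordCount-above (suc L) ≤-refl | tailCount-top
    | tailCount≡fanSum⁺ zero L refl | fanSum⁺-suc zero L = +-comm 1 _
  tail (suc d) (suc k) e rewrite tailCount-false-suc L (suc k) | fanWordCount≡fanSum d (suc k) (suc-injective e)
    | tailCount≡fanSum⁺ d (suc k) (suc-injective e) | tailCount≡fanSum⁺ (suc d) k (trans (sym (+-suc d k)) (suc-injective e))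
    | fanSum⁺-suc (suc d) k | fanSum-suc d (suc k) = +-comm (fanSum d (suc k) + fanSum⁺ d (suc k)) (fanSum⁺ (suc d) k)
  tail-top : tailCount false (suc L) (suc (suc L)) ≡ 1
  tail-top rewrite tailCount-false-suc L (suc (suc L)) | fanWordCount-above (suc (suc L)) (<-trans (n<1+n L) (n<1+n (suc L)))
    | tailCount-above (suc (suc L)) ≤-refl | tailCount-top = refl
  tail-above : ∀ k → suc (suc L) < k → tailCount false (suc L) k ≡ 0
  tail-above (suc k) lt rewrite tailCount-false-suc L (suc k)
    | fanWordCount-above (suc k) (<-trans (<-trans (n<1+n L) (n<1+n (suc L))) lt)
    | tailCount-above (suc k) (<-trans (n<1+n (suc L)) lt) | tailCount-above k (≤-pred lt) = refl

countsAt : ∀ L → CountsAt L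
countsAt zero = countsAt-zero
countsAt (suc L) = countsAt-suc L (countsAt L)

fanCount≡fanSum : ∀ d k → fanCount (suc (d + k)) k ≡ fanSum d k
fanCount≡fanSum d k
  rewrite map-applyUpTo (λ r → r) (λ r → ((suc (d + k) ∸ k ∸ 1) C r) * ((r + k) C r)) (suc (d + k) ∸ k)
        | m+n∸n≡m (suc d) k = refl

length-fanWords≡fanCount : ∀ d k → length (fanWords (d + k) k) ≡ fanCount (suc (d + k)) k
length-fanWords≡fanCount d k =
  trans (length-fanWords (d + k) k) (trans (CountsAt.fanWordCount≡fanSum (countsAt (d + k)) d k refl) (sym (fanCount≡fanSum d k)))

recurrent×level⇔isFanWord : ∀ {L} k (c : Config (suc L)) → (Recurrent c × HasLevel c k) ⇔ IsFanWord L k c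
recurrent×level⇔isFanWord k c = mk⇔
  (λ (rec , level) →
    let (fb , acc) = Equivalence.to (stable×noForbidden⇔fanBounded×accepted c) (Equivalence.to recurrent⇔stable×noForbidden rec)
    in fb , acc , level)
  (λ (fb , acc , level) →
    Equivalence.from recurrent⇔stable×noForbidden (Equivalence.from (stable×noForbidden⇔fanBounded×accepted c) (fb , acc)) , level)

recurrent-count : ∀ d k → HasCount (λ (c : Config (suc (d + k))) → Recurrent c × HasLevel c k) (fanCount (suc (d + k)) k)
recurrent-count d k =
  fanWords (d + k) k , fanWords-unique (d + k) k ,
  (λ c → ⇔-trans (∈fanWords⇔isFanWord (d + k) k c) (⇔-sym (recurrent×level⇔isFanWord k c))) ,
  length-fanWords≡fanCount d k

corollary5p8 : (n k : ℕ) → 1 ≤ n → k < n →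
    HasCount (λ (c : Config n) → Recurrent c × HasLevel c k) (fanCount n k)
corollary5p8 (suc L) k _ k<n =
  subst (λ N → HasCount (λ (c : Config N) → Recurrent c × HasLevel c k) (fanCount N k))
        (cong suc (m∸n+n≡m (≤-pred k<n)))
        (recurrent-count (L ∸ k) k)
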